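{- Let $F$ be a quadratic number field with discriminant $\delta\neq-3$ and ring of integers $A$, and let $n$ be an odd divisor of $\delta$. If $F$ is real, assume that the fundamental unit $\varepsilon=(\varepsilon_1+\varepsilon_2\sqrt\delta)/2$ ($\varepsilon_1,\varepsilon_2\in\mathbf Z$) satisfies $n\mid\varepsilon_2$. Suppose $(\alpha,\beta,b)\in\mathbf Z^3$ satisfies $\alpha^2-4b^n=\delta\beta^2$ with $\gcd(b,\alpha)=\gcd(\beta,n)=\gcd(\alpha,n)=1$. Then the class group $Cl(A)$ has an element of order $n$. -}

module Defs where

open import Level using (0ℓ)
open import Data.Nat as ℕ using (ℕ; zero; suc)
import Data.Nat.Divisibility as ℕD
open import Data.Integer using (ℤ; +_; _+_; _*_; _-_; -_; ∣_∣; 0ℤ; 1ℤ; _<_)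
open import Data.Integer.DivMod using (_/ℕ_; _%ℕ_)
open import Data.Product using (Σ; ∃; _×_; _,_)
open import Data.Sum using (_⊎_)
open import Data.List using (List; []; _∷_)
open import Relation.Binary.PropositionalEquality using (_≡_)
open import Relation.Nullary using (¬_)
open import Relation.Unary using (Pred; _∈_)

SquareFree : ℤ → Set
SquareFree d = ∀ (k : ℕ) → (k ℕ.* k) ℕD.∣ ∣ d ∣ → k ≡ 1

IsQuadDisc : ℤ → Set
IsQuadDisc δ =
  ¬ (δ ≡ 1ℤ) ×
  ((δ %ℕ 4 ≡ 1 × SquareFree δ)
   ⊎ Σ ℤ (λ m → δ ≡ + 4 * m × (m %ℕ 4 ≡ 2 ⊎ m %ℕ 4 ≡ 3) × SquareFree m))

-- The ring of integers A = ℤ[ω], ω = (δ + √δ)/2, of F = ℚ(√δ).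
-- An element (x , y) stands for x + y ω.  ω² = δ ω - (δ² - δ)/4.

module Quad (δ : ℤ) where

  A : Set
  A = ℤ × ℤ

  -- (δ² - δ)/4 (an exact division since δ ≡ 0,1 mod 4)
  c : ℤ
  c = (δ * δ - δ) /ℕ 4

  0A : A
  0A = 0ℤ , 0ℤ

  1A : A
  1A = 1ℤ , 0ℤ

  _+A_ : A → A → A
  (x₁ , y₁) +A (x₂ , y₂) = (x₁ + x₂) , (y₁ + y₂)

  -A_ : A → A
  -A (x , y) = (- x) , (- y)

  _*A_ : A → A → A
  (x₁ , y₁) *A (x₂ , y₂) =
    (x₁ * x₂ - c * (y₁ * y₂)) , (x₁ * y₂ + x₂ * y₁ + δ * (y₁ * y₂))

  _^A_ : A → ℕ → A
  a ^A zero = 1A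
  a ^A suc k = a *A (a ^A k)

  -- For a = x + y ω = (a₁ + a₂ √δ)/2 we have a₁ = 2x + δ y and a₂ = y.
  coord₁ : A → ℤ
  coord₁ (x , y) = + 2 * x + δ * y

  coord₂ : A → ℤ
  coord₂ (x , y) = y

  IsUnit : A → Set
  IsUnit u = Σ A (λ v → u *A v ≡ 1A)

  -- ε = (ε₁ + ε₂ √δ)/2 is the fundamental unit: ε > 1 (equivalently, for a
  -- unit, ε₁ > 0 and ε₂ > 0) and every unit is ± ε^k for some k ∈ ℤ.
  IsFundamentalUnit : A → Set
  IsFundamentalUnit ε =
    IsUnit ε × 0ℤ < coord₁ ε × 0ℤ < coord₂ ε ×
    (∀ u → IsUnit u → Σ ℕ (λ k →
        (u ≡ ε ^A k) ⊎ (u ≡ -A (ε ^A k))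
        ⊎ (u *A (ε ^A k) ≡ 1A) ⊎ (u *A (ε ^A k) ≡ -A 1A)))

  IsIdeal : Pred A 0ℓ → Set
  IsIdeal I =
    0A ∈ I ×
    (∀ a b → a ∈ I → b ∈ I → (a +A b) ∈ I) ×
    (∀ r a → a ∈ I → (r *A a) ∈ I)

  NonZeroIdeal : Pred A 0ℓ → Set
  NonZeroIdeal I = Σ A (λ a → a ∈ I × ¬ (a ≡ 0A))

  data SumOfProducts (I J : Pred A 0ℓ) : A → Set where
    sp-nil  : SumOfProducts I J 0A
    sp-cons : ∀ {s} i j → i ∈ I → j ∈ J → SumOfProducts I J s →
              SumOfProducts I J ((i *A j) +A s)

  _·_ : Pred A 0ℓ → Pred A 0ℓ → Pred A 0ℓ
  I · J = SumOfProducts I J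

  unitIdeal : Pred A 0ℓ
  unitIdeal _ = A

  _^I_ : Pred A 0ℓ → ℕ → Pred A 0ℓ
  I ^I zero = unitIdeal
  I ^I suc k = I · (I ^I k)

  IsPrincipal : Pred A 0ℓ → Set
  IsPrincipal I = Σ A (λ g → ∀ x → (x ∈ I → Σ A (λ r → x ≡ g *A r))
                                  × (Σ A (λ r → x ≡ g *A r) → x ∈ I))

  ClassHasOrder : Pred A 0ℓ → ℕ → Set
  ClassHasOrder I n =
    IsPrincipal (I ^I n) × (∀ d → 0 ℕ.< d → d ℕ.< n → ¬ IsPrincipal (I ^I d))

  ClHasElementOfOrder : ℕ → Set₁
  ClHasElementOfOrder n =
    Σ (Pred A 0ℓ) (λ I → IsIdeal I × NonZeroIdeal I × ClassHasOrder I n)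

-- Let μ = (α + β√δ)/2 ∈ A. Then μ μ̄ = bⁿ, and gcd(b, α) = 1 makes μ and μ̄ coprime, so for the ideal
-- I = (b, μ) one gets Iᵏ = (bᵏ, μ) = {x | bᵏ divides x μ̄} for k ≤ n; in particular Iⁿ = (μ) is principal.
-- The exponents k ≤ n with Iᵏ principal are closed under subtraction, so if some Iᵈ with 0 < d < n were
-- principal, so would be I^g for a proper divisor g of n, and then μ = γ^q r with q = n/g > 1 and r a unit.
-- But q is odd and divides δ, hence also (δ² - δ)/4, so ω² ≡ 0 and (x + yω)^q ≡ x^q modulo q. The units
-- have second coordinate divisible by q too: for δ < 0 they are ±1 (here |δ| ≥ 5), and for δ > 0 they are
-- ±εᵏ or conjugates of these, where the fundamental unit ε = (ε₁ + ε₂√δ)/2 is found as the unit with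
-- ε₁, ε₂ > 0 minimising ε₁ + ε₂. Hence q divides β, contradicting gcd(β, n) = 1.

module Submission where

open import Defs
open import Level using (0ℓ)
open import Algebra.Bundles using (CommutativeRing)
import Algebra.Solver.Ring.AlmostCommutativeRing as ACR
open import Data.Empty using (⊥-elim)
open import Data.Integer as ℤ using (ℤ; +_; -[1+_]; _+_; _*_; _-_; -_; _^_; 0ℤ; 1ℤ; -1ℤ; ∣_∣; _<_)
import Data.Integer.Properties as ℤP
open import Data.Integer.DivMod using (_/ℕ_; _%ℕ_; a≡a%ℕn+[a/ℕn]*n; n%ℕd<d)
open import Data.Integer.Divisibility using (_∣_)
open import Data.Integer.Divisibility.Signed as ℤS using (divides) renaming (_∣_ to _∣ˢ_)
open import Data.Integer.GCD using (gcd; gcd-greatest)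
open import Data.Integer.Tactic.RingSolver using (solve-∀)
open import Data.Maybe using (Maybe; just; nothing)
open import Data.Nat as ℕ using (ℕ; zero; suc; z≤n; s≤s)
import Data.Nat.Properties as ℕP
import Data.Nat.Divisibility as ℕD
open ℕD using () renaming (_∣_ to _∣ℕ_)
import Data.Nat.GCD as ℕG
import Data.Nat.Coprimality as ℕC
open import Data.Nat.Induction using (<-wellFounded)
import Data.Nat.Tactic.RingSolver as ℕS
open import Data.Product using (Σ; _×_; _,_; proj₁; proj₂)
open import Data.Sum using (_⊎_; inj₁; inj₂; [_,_])
open import Function using (_∘_)
open import Function.Bundles using (_⇔_; mk⇔; module Equivalence)
open import Induction.WellFounded using (Acc; acc)
open import Relation.Binary.Definitions using (Tri; tri<; tri≈; tri>)
open import Relation.Binary.PropositionalEquality hiding ([_])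
open import Relation.Nullary using (¬_; Dec; yes; no)
open import Relation.Nullary.Decidable as Dec using (_×-dec_; _⊎-dec_)
open import Relation.Unary using (Pred; _∈_; _⊆_)

IsUnitℤ : ℤ → Set
IsUnitℤ s = s ≡ 1ℤ ⊎ s ≡ -1ℤ

IsUnitℤ? : ∀ i → Dec (IsUnitℤ i)
IsUnitℤ? i = (i ℤ.≟ 1ℤ) ⊎-dec (i ℤ.≟ -1ℤ)

*-IsUnitℤ : ∀ {i j} → IsUnitℤ i → IsUnitℤ j → IsUnitℤ (i * j)
*-IsUnitℤ (inj₁ refl) (inj₁ refl) = inj₁ refl
*-IsUnitℤ (inj₁ refl) (inj₂ refl) = inj₂ refl
*-IsUnitℤ (inj₂ refl) (inj₁ refl) = inj₂ refl
*-IsUnitℤ (inj₂ refl) (inj₂ refl) = inj₁ refl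

neg-IsUnitℤ : ∀ {i} → IsUnitℤ i → IsUnitℤ (- i)
neg-IsUnitℤ (inj₁ refl) = inj₂ refl
neg-IsUnitℤ (inj₂ refl) = inj₁ refl

IsUnitℤ⇒i*i≡1 : ∀ {i} → IsUnitℤ i → i * i ≡ 1ℤ
IsUnitℤ⇒i*i≡1 (inj₁ refl) = refl
IsUnitℤ⇒i*i≡1 (inj₂ refl) = refl

i*j≡1⇒IsUnitℤ : ∀ i j → i * j ≡ 1ℤ → IsUnitℤ i
i*j≡1⇒IsUnitℤ i j i*j≡1 with ℕP.m*n≡1⇒m≡1 ∣ i ∣ ∣ j ∣ (trans (sym (ℤP.abs-* i j)) (cong ∣_∣ i*j≡1))
i*j≡1⇒IsUnitℤ (+ .1)      j _ | refl = inj₁ refl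
i*j≡1⇒IsUnitℤ -[1+ .0 ]   j _ | refl = inj₂ refl

i*i≡∣i∣*∣i∣ : ∀ i → i * i ≡ + (∣ i ∣ ℕ.* ∣ i ∣)
i*i≡∣i∣*∣i∣ (+ m)    = sym (ℤP.pos-* m m)
i*i≡∣i∣*∣i∣ -[1+ m ] = refl

0<i⇒0<∣i∣ : ∀ {i} → 0ℤ < i → 0 ℕ.< ∣ i ∣
0<i⇒0<∣i∣ {+ _} (ℤ.+<+ 0<m) = 0<m

0<i⇒i≡+∣i∣ : ∀ {i} → 0ℤ < i → i ≡ + ∣ i ∣
0<i⇒i≡+∣i∣ {+ _} _ = refl

i<0⇒i≡-+∣i∣ : ∀ {i} → i < 0ℤ → i ≡ - + ∣ i ∣
i<0⇒i≡-+∣i∣ { -[1+ _ ]} _ = refl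
i<0⇒i≡-+∣i∣ {+ _} (ℤ.+<+ ())

∣i∣≡3⇒i≡±3 : ∀ {i} → ∣ i ∣ ≡ 3 → i ≡ + 3 ⊎ i ≡ - + 3
∣i∣≡3⇒i≡±3 {+ .3}      refl = inj₁ refl
∣i∣≡3⇒i≡±3 { -[1+ .2 ]} refl = inj₂ refl

+2*i≡+m⇒2*∣i∣≡m : ∀ {i m} → + 2 * i ≡ + m → 2 ℕ.* ∣ i ∣ ≡ m
+2*i≡+m⇒2*∣i∣≡m {+ k} 2k≡m = ℤP.+-injective (trans (ℤP.pos-* 2 k) 2k≡m)

+2*i≡+m⇒0<i : ∀ {i m} → + 2 * i ≡ + m → 0 ℕ.< m → 0ℤ < i
+2*i≡+m⇒0<i {+ zero}    refl ()
+2*i≡+m⇒0<i {+ suc _}   _    _ = ℤ.+<+ (s≤s z≤n)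

[i*d]/ℕd≡i : ∀ i d .{{_ : ℕ.NonZero d}} → (i * + d) /ℕ d ≡ i
[i*d]/ℕd≡i i (suc d′) = begin
  Q             ≡⟨ ℤP.+-identityˡ Q ⟨
  0ℤ + Q        ≡⟨ cong (_+ Q) (quotient-exact (i - Q) [i-Q]*d≡r) ⟨
  (i - Q) + Q   ≡⟨ cancel i Q ⟩
  i             ∎
  where
  open ≡-Reasoning
  d : ℕ
  d = suc d′
  Q : ℤ
  Q = (i * + d) /ℕ d
  r : ℕ
  r = (i * + d) %ℕ d
  cancel : ∀ i Q → i - Q + Q ≡ i
  cancel = solve-∀
  [i-Q]*d≡r : (i - Q) * + d ≡ + r
  [i-Q]*d≡r = begin
    (i - Q) * + d             ≡⟨ distrib i Q (+ d) ⟩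
    i * + d - Q * + d         ≡⟨ cong (_- Q * + d) (a≡a%ℕn+[a/ℕn]*n (i * + d) d) ⟩
    + r + Q * + d - Q * + d   ≡⟨ cancel′ (+ r) (Q * + d) ⟩
    + r                       ∎
    where
    distrib : ∀ i Q d → (i - Q) * d ≡ i * d - Q * d
    distrib = solve-∀
    cancel′ : ∀ r x → r + x - x ≡ r
    cancel′ = solve-∀
  quotient-exact : ∀ e → e * + d ≡ + r → e ≡ 0ℤ
  quotient-exact (+ zero)  _      = refl
  quotient-exact (+ suc j) e*d≡r  = ⊥-elim (ℕP.<-irrefl refl (ℕP.<-≤-trans (n%ℕd<d (i * + d) d)
    (ℕP.≤-trans (ℕP.m≤m+n d (j ℕ.* d)) (ℕP.≤-reflexive (ℤP.+-injective (trans (ℤP.pos-* (suc j) d) e*d≡r))))))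
  quotient-exact -[1+ j ] ()

i[i-1]-even : ∀ i → Σ ℤ λ t → i * (i - 1ℤ) ≡ + 2 * t
i[i-1]-even i with i %ℕ 2 | a≡a%ℕn+[a/ℕn]*n i 2 | n%ℕd<d i 2
... | 0 | i≡2Q | _ = Q * (Q * + 2 - 1ℤ) , trans (cong (λ j → j * (j - 1ℤ)) i≡2Q) (even Q)
  where
  Q : ℤ
  Q = i /ℕ 2
  even : ∀ Q → (+ 0 + Q * + 2) * (+ 0 + Q * + 2 - 1ℤ) ≡ + 2 * (Q * (Q * + 2 - 1ℤ))
  even = solve-∀
... | 1 | i≡1+2Q | _ = (1ℤ + Q * + 2) * Q , trans (cong (λ j → j * (j - 1ℤ)) i≡1+2Q) (odd Q)
  where
  Q : ℤ
  Q = i /ℕ 2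
  odd : ∀ Q → (+ 1 + Q * + 2) * (+ 1 + Q * + 2 - 1ℤ) ≡ + 2 * ((1ℤ + Q * + 2) * Q)
  odd = solve-∀
... | suc (suc _) | _ | s≤s (s≤s ())

BézoutPair : ℤ → ℤ → Set
BézoutPair i j = Σ ℤ λ u → Σ ℤ λ v → u * i + v * j ≡ 1ℤ

ℕ-bézout⇒BézoutPair : ∀ {m n} → ℕG.Bézout.Identity 1 m n → BézoutPair (+ m) (+ n)
ℕ-bézout⇒BézoutPair {m} {n} (ℕG.Bézout.+- x y 1+yn≡xm) = + x , - + y , (begin
  + x * + m + - + y * + n       ≡⟨ cong₂ _+_ (ℤP.pos-* x m) (trans (cong -_ (ℤP.pos-* y n)) (ℤP.neg-distribˡ-* (+ y) (+ n))) ⟨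
  + (x ℕ.* m) + - + (y ℕ.* n)   ≡⟨ cong (λ a → + a + - + (y ℕ.* n)) 1+yn≡xm ⟨
  + (1 ℕ.+ y ℕ.* n) - + (y ℕ.* n) ≡⟨ cong (_- + (y ℕ.* n)) (ℤP.pos-+ 1 (y ℕ.* n)) ⟩
  1ℤ + + (y ℕ.* n) - + (y ℕ.* n) ≡⟨ cancel (+ (y ℕ.* n)) ⟩
  1ℤ                            ∎)
  where
  open ≡-Reasoning
  cancel : ∀ a → 1ℤ + a - a ≡ 1ℤ
  cancel = solve-∀
ℕ-bézout⇒BézoutPair {m} {n} (ℕG.Bézout.-+ x y 1+xm≡yn) = - + x , + y , (begin
  - + x * + m + + y * + n       ≡⟨ cong₂ _+_ (trans (cong -_ (ℤP.pos-* x m)) (ℤP.neg-distribˡ-* (+ x) (+ m))) (ℤP.pos-* y n) ⟨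
  - + (x ℕ.* m) + + (y ℕ.* n)   ≡⟨ cong (λ b → - + (x ℕ.* m) + + b) 1+xm≡yn ⟨
  - + (x ℕ.* m) + + (1 ℕ.+ x ℕ.* m) ≡⟨ cong (λ b → - + (x ℕ.* m) + b) (ℤP.pos-+ 1 (x ℕ.* m)) ⟩
  - + (x ℕ.* m) + (1ℤ + + (x ℕ.* m)) ≡⟨ cancel (+ (x ℕ.* m)) ⟩
  1ℤ                            ∎)
  where
  open ≡-Reasoning
  cancel : ∀ a → - a + (1ℤ + a) ≡ 1ℤ
  cancel = solve-∀

gcd≡1⇒BézoutPair : ∀ i j → ℕG.gcd ∣ i ∣ ∣ j ∣ ≡ 1 → BézoutPair i j
gcd≡1⇒BézoutPair i j gcd≡1 with ℕ-bézout⇒BézoutPair (ℕC.coprime-Bézout (ℕC.gcd≡1⇒coprime gcd≡1))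
... | u , v , u∣i∣+v∣j∣≡1 = u * sign i , v * sign j , (begin
  u * sign i * i + v * sign j * j       ≡⟨ cong₂ _+_ (ℤP.*-assoc u (sign i) i) (ℤP.*-assoc v (sign j) j) ⟩
  u * (sign i * i) + v * (sign j * j)   ≡⟨ cong₂ (λ a b → u * a + v * b) (sign*i≡+∣i∣ i) (sign*i≡+∣i∣ j) ⟩
  u * + ∣ i ∣ + v * + ∣ j ∣             ≡⟨ u∣i∣+v∣j∣≡1 ⟩
  1ℤ                                    ∎)
  where
  open ≡-Reasoning
  sign : ℤ → ℤ
  sign (+ _)    = 1ℤ
  sign -[1+ _ ] = -1ℤ
  sign*i≡+∣i∣ : ∀ i → sign i * i ≡ + ∣ i ∣
  sign*i≡+∣i∣ (+ m)    = ℤP.*-identityˡ (+ m)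
  sign*i≡+∣i∣ -[1+ m ] = ℤP.-1*i≡-i -[1+ m ]

BézoutPair-^ : ∀ {i j} → BézoutPair i j → ∀ k → BézoutPair (i ^ k) j
BézoutPair-^ _ zero = 1ℤ , 0ℤ , refl
BézoutPair-^ {i} {j} (u , v , ui+vj≡1) (suc k) with BézoutPair-^ (u , v , ui+vj≡1) k
... | u′ , v′ , u′iᵏ+v′j≡1 = u * u′ , u * i * v′ + v * (u′ * i ^ k) + v * v′ * j , (begin
  u * u′ * (i * i ^ k) + (u * i * v′ + v * (u′ * i ^ k) + v * v′ * j) * j ≡⟨ expand u v u′ v′ i (i ^ k) j ⟩
  (u * i + v * j) * (u′ * i ^ k + v′ * j)                                   ≡⟨ cong₂ _*_ ui+vj≡1 u′iᵏ+v′j≡1 ⟩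
  1ℤ                                                                        ∎)
  where
  open ≡-Reasoning
  expand : ∀ u v u′ v′ i iᵏ j →
    u * u′ * (i * iᵏ) + (u * i * v′ + v * (u′ * iᵏ) + v * v′ * j) * j ≡ (u * i + v * j) * (u′ * iᵏ + v′ * j)
  expand = solve-∀

m²+D*k²≡4⇒k≡0 : ∀ {m k D} → 5 ℕ.≤ D → m ℕ.* m ℕ.+ D ℕ.* (k ℕ.* k) ≡ 4 → k ≡ 0
m²+D*k²≡4⇒k≡0 {k = zero}  _   _ = refl
m²+D*k²≡4⇒k≡0 {m} {k = suc k} {D} 5≤D m²+Dk²≡4 = ⊥-elim (ℕP.<-irrefl refl (begin-strict
  4                               <⟨ 5≤D ⟩
  D                               ≤⟨ ℕP.m≤m*n D (suc k ℕ.* suc k) ⟩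
  D ℕ.* (suc k ℕ.* suc k)         ≤⟨ ℕP.m≤n+m _ (m ℕ.* m) ⟩
  m ℕ.* m ℕ.+ D ℕ.* (suc k ℕ.* suc k) ≡⟨ m²+Dk²≡4 ⟩
  4                               ∎))
  where open ℕP.≤-Reasoning

2*[b₁+b₂]<a₁b₁+Da₂b₂+[a₁b₂+a₂b₁] :
  ∀ {a₁ a₂ b₁ b₂ D} → 0 ℕ.< a₁ → 0 ℕ.< a₂ → 0 ℕ.< b₁ → 0 ℕ.< b₂ → 2 ℕ.≤ D →
  2 ℕ.* (b₁ ℕ.+ b₂) ℕ.< a₁ ℕ.* b₁ ℕ.+ D ℕ.* (a₂ ℕ.* b₂) ℕ.+ (a₁ ℕ.* b₂ ℕ.+ a₂ ℕ.* b₁)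
2*[b₁+b₂]<a₁b₁+Da₂b₂+[a₁b₂+a₂b₁] {suc a₁} {suc a₂} {suc b₁} {suc b₂} {suc (suc d)}
                                  (s≤s _) (s≤s _) (s≤s _) (s≤s _) (s≤s (s≤s _)) =
  subst (2 ℕ.* (suc b₁ ℕ.+ suc b₂) ℕ.<_) (sym (split a₁ a₂ b₁ b₂ d)) (ℕP.m<m+n _ (s≤s z≤n))
  where
  -- the excess over 2 (b₁ + b₂) is written out as a successor
  split : ∀ a₁ a₂ b₁ b₂ d →
    suc a₁ ℕ.* suc b₁ ℕ.+ suc (suc d) ℕ.* (suc a₂ ℕ.* suc b₂) ℕ.+ (suc a₁ ℕ.* suc b₂ ℕ.+ suc a₂ ℕ.* suc b₁)
    ≡ 2 ℕ.* (suc b₁ ℕ.+ suc b₂) ℕ.+ suc (b₂ ℕ.+ (2 ℕ.* a₁ ℕ.+ a₁ ℕ.* b₁ ℕ.+ 3 ℕ.* a₂ ℕ.+ 2 ℕ.* (a₂ ℕ.* b₂)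
        ℕ.+ d ℕ.+ d ℕ.* a₂ ℕ.+ d ℕ.* b₂ ℕ.+ d ℕ.* (a₂ ℕ.* b₂) ℕ.+ a₁ ℕ.* b₂ ℕ.+ a₂ ℕ.* b₁))
  split = ℕS.solve-∀

4*k≢t : ∀ {k t} → 0 ℕ.< t → t ℕ.< 4 → 4 ℕ.* k ≢ t
4*k≢t {zero} {zero}  () _ _
4*k≢t {zero} {suc _} _  _ ()
4*k≢t {suc k} _ t<4 refl = ℕP.<-irrefl refl (ℕP.<-≤-trans t<4 (ℕP.m≤m*n 4 (suc k)))

odd∣4⇒≡1 : ∀ {i} → ¬ 2 ∣ℕ i → i ∣ℕ 4 → i ≡ 1
odd∣4⇒≡1 {0} _   0∣4 with () ← ℕD.0∣⇒≡0 0∣4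
odd∣4⇒≡1 {1} _   _   = refl
odd∣4⇒≡1 {2} 2∤2 _   = ⊥-elim (2∤2 ℕD.∣-refl)
odd∣4⇒≡1 {3} _   3∣4 with () ← ℕD.n∣m⇒m%n≡0 4 3 3∣4
odd∣4⇒≡1 {4} 2∤4 _   = ⊥-elim (2∤4 (ℕD.divides 2 refl))
odd∣4⇒≡1 {suc (suc (suc (suc (suc _))))} _ i∣4 with ℕD.∣⇒≤ i∣4
... | s≤s (s≤s (s≤s (s≤s ())))

3≤odd : ∀ {q} → 1 ℕ.< q → ¬ 2 ∣ℕ q → 3 ℕ.≤ q
3≤odd 1<q 2∤q = ℕP.≤∧≢⇒< 1<q (λ 2≡q → 2∤q (subst (2 ∣ℕ_) 2≡q ℕD.∣-refl))

odd-divisor⇒5≤ : ∀ {q d} → q ∣ℕ d → 1 ℕ.< q → ¬ 2 ∣ℕ q → d ≢ 0 → d ≢ 3 → 5 ℕ.≤ d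
odd-divisor⇒5≤ {q} {d} q∣d 1<q 2∤q d≢0 d≢3 = ℕP.≤∧≢⇒< (ℕP.≤∧≢⇒< 3≤d (d≢3 ∘ sym)) 4≢d
  where
  3≤d : 3 ℕ.≤ d
  3≤d = ℕP.≤-trans (3≤odd 1<q 2∤q) (ℕD.∣⇒≤ {{ℕ.≢-nonZero d≢0}} q∣d)
  4≢d : 4 ≢ d
  4≢d 4≡d = ℕP.<-irrefl refl (ℕP.<-≤-trans 1<q (ℕP.≤-reflexive (odd∣4⇒≡1 2∤q (subst (q ∣ℕ_) (sym 4≡d) q∣d))))

module _ {P : ℕ → Set} (P-∸ : ∀ {x y} → x ℕ.≤ y → P x → P y → P (y ℕ.∸ x)) where

  ∸-closed⇒common-divisor : ∀ {x y} → Acc ℕ._<_ (x ℕ.+ y) → 0 ℕ.< x → 0 ℕ.< y → P x → P y →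
                            Σ ℕ λ g → 0 ℕ.< g × g ∣ℕ x × g ∣ℕ y × P g
  ∸-closed⇒common-divisor {x} {y} (acc rec) 0<x 0<y Px Py with ℕP.<-cmp x y
  ... | tri≈ _ refl _ = x , 0<x , ℕD.∣-refl , ℕD.∣-refl , Px
  ... | tri< x<y _ _ with ∸-closed⇒common-divisor (rec smaller) 0<x (ℕP.m<n⇒0<n∸m x<y) Px (P-∸ (ℕP.<⇒≤ x<y) Px Py)
    where
    smaller : x ℕ.+ (y ℕ.∸ x) ℕ.< x ℕ.+ y
    smaller = subst (ℕ._< x ℕ.+ y) (sym (ℕP.m+[n∸m]≡n (ℕP.<⇒≤ x<y))) (ℕP.m<n+m y 0<x)
  ... | g , 0<g , g∣x , g∣y∸x , Pg = g , 0<g , g∣x , ℕD.∣m∸n∣n⇒∣m g (ℕP.<⇒≤ x<y) g∣y∸x g∣x , Pg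
  ∸-closed⇒common-divisor {x} {y} (acc rec) 0<x 0<y Px Py | tri> _ _ y<x
    with ∸-closed⇒common-divisor (rec smaller) 0<y (ℕP.m<n⇒0<n∸m y<x) Py (P-∸ (ℕP.<⇒≤ y<x) Py Px)
    where
    smaller : y ℕ.+ (x ℕ.∸ y) ℕ.< x ℕ.+ y
    smaller = subst (ℕ._< x ℕ.+ y) (sym (ℕP.m+[n∸m]≡n (ℕP.<⇒≤ y<x))) (ℕP.m<m+n x 0<y)
  ... | g , 0<g , g∣y , g∣x∸y , Pg = g , 0<g , ℕD.∣m∸n∣n⇒∣m g (ℕP.<⇒≤ y<x) g∣x∸y g∣y , g∣y , Pg

module QuadraticInteger (δ : ℤ) where
  open Quad δ public
  open import Algebra.Structures {A = A} _≡_ using (IsCommutativeRing)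

  infixl 6 _⊕_
  infixl 7 _⊙_
  infix 8 ⊖_

  _⊕_ : A → A → A
  _⊕_ = _+A_

  _⊙_ : A → A → A
  _⊙_ = _*A_

  ⊖_ : A → A
  ⊖_ = -A_

  ⊕-assoc : ∀ a b e → a ⊕ b ⊕ e ≡ a ⊕ (b ⊕ e)
  ⊕-assoc (x₁ , y₁) (x₂ , y₂) (x₃ , y₃) = cong₂ _,_ (ℤP.+-assoc x₁ x₂ x₃) (ℤP.+-assoc y₁ y₂ y₃)

  ⊕-comm : ∀ a b → a ⊕ b ≡ b ⊕ a
  ⊕-comm (x₁ , y₁) (x₂ , y₂) = cong₂ _,_ (ℤP.+-comm x₁ x₂) (ℤP.+-comm y₁ y₂)

  ⊕-identityˡ : ∀ a → 0A ⊕ a ≡ a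
  ⊕-identityˡ (x , y) = cong₂ _,_ (ℤP.+-identityˡ x) (ℤP.+-identityˡ y)

  ⊕-identityʳ : ∀ a → a ⊕ 0A ≡ a
  ⊕-identityʳ (x , y) = cong₂ _,_ (ℤP.+-identityʳ x) (ℤP.+-identityʳ y)

  ⊖-inverseˡ : ∀ a → ⊖ a ⊕ a ≡ 0A
  ⊖-inverseˡ (x , y) = cong₂ _,_ (ℤP.+-inverseˡ x) (ℤP.+-inverseˡ y)

  ⊖-inverseʳ : ∀ a → a ⊕ ⊖ a ≡ 0A
  ⊖-inverseʳ (x , y) = cong₂ _,_ (ℤP.+-inverseʳ x) (ℤP.+-inverseʳ y)

  ⊙-comm : ∀ a b → a ⊙ b ≡ b ⊙ a
  ⊙-comm (x₁ , y₁) (x₂ , y₂) = cong₂ _,_ (first c x₁ y₁ x₂ y₂) (second δ x₁ y₁ x₂ y₂)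
    where
    first : ∀ c x₁ y₁ x₂ y₂ → x₁ * x₂ - c * (y₁ * y₂) ≡ x₂ * x₁ - c * (y₂ * y₁)
    first = solve-∀
    second : ∀ d x₁ y₁ x₂ y₂ →
             x₁ * y₂ + x₂ * y₁ + d * (y₁ * y₂) ≡ x₂ * y₁ + x₁ * y₂ + d * (y₂ * y₁)
    second = solve-∀

  ⊙-identityˡ : ∀ a → 1A ⊙ a ≡ a
  ⊙-identityˡ (x , y) = cong₂ _,_ (first c x y) (second δ x y)
    where
    first : ∀ c x y → 1ℤ * x - c * (0ℤ * y) ≡ x
    first = solve-∀
    second : ∀ d x y → 1ℤ * y + x * 0ℤ + d * (0ℤ * y) ≡ y
    second = solve-∀

  ⊙-identityʳ : ∀ a → a ⊙ 1A ≡ a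
  ⊙-identityʳ a = trans (⊙-comm a 1A) (⊙-identityˡ a)

  ⊙-assoc : ∀ a b e → a ⊙ b ⊙ e ≡ a ⊙ (b ⊙ e)
  ⊙-assoc (x₁ , y₁) (x₂ , y₂) (x₃ , y₃) =
    cong₂ _,_ (first δ c x₁ y₁ x₂ y₂ x₃ y₃) (second δ c x₁ y₁ x₂ y₂ x₃ y₃)
    where
    first : ∀ d c x₁ y₁ x₂ y₂ x₃ y₃ →
      (x₁ * x₂ - c * (y₁ * y₂)) * x₃ - c * ((x₁ * y₂ + x₂ * y₁ + d * (y₁ * y₂)) * y₃)
      ≡ x₁ * (x₂ * x₃ - c * (y₂ * y₃)) - c * (y₁ * (x₂ * y₃ + x₃ * y₂ + d * (y₂ * y₃)))
    first = solve-∀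
    second : ∀ d c x₁ y₁ x₂ y₂ x₃ y₃ →
      (x₁ * x₂ - c * (y₁ * y₂)) * y₃ + x₃ * (x₁ * y₂ + x₂ * y₁ + d * (y₁ * y₂))
        + d * ((x₁ * y₂ + x₂ * y₁ + d * (y₁ * y₂)) * y₃)
      ≡ x₁ * (x₂ * y₃ + x₃ * y₂ + d * (y₂ * y₃)) + (x₂ * x₃ - c * (y₂ * y₃)) * y₁
        + d * (y₁ * (x₂ * y₃ + x₃ * y₂ + d * (y₂ * y₃)))
    second = solve-∀

  ⊙-distribˡ-⊕ : ∀ a b e → a ⊙ (b ⊕ e) ≡ a ⊙ b ⊕ a ⊙ e
  ⊙-distribˡ-⊕ (x₁ , y₁) (x₂ , y₂) (x₃ , y₃) =
    cong₂ _,_ (first c x₁ y₁ x₂ y₂ x₃ y₃) (second δ x₁ y₁ x₂ y₂ x₃ y₃)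
    where
    first : ∀ c x₁ y₁ x₂ y₂ x₃ y₃ →
      x₁ * (x₂ + x₃) - c * (y₁ * (y₂ + y₃))
      ≡ (x₁ * x₂ - c * (y₁ * y₂)) + (x₁ * x₃ - c * (y₁ * y₃))
    first = solve-∀
    second : ∀ d x₁ y₁ x₂ y₂ x₃ y₃ →
      x₁ * (y₂ + y₃) + (x₂ + x₃) * y₁ + d * (y₁ * (y₂ + y₃))
      ≡ (x₁ * y₂ + x₂ * y₁ + d * (y₁ * y₂)) + (x₁ * y₃ + x₃ * y₁ + d * (y₁ * y₃))
    second = solve-∀

  ⊙-distribʳ-⊕ : ∀ a b e → (b ⊕ e) ⊙ a ≡ b ⊙ a ⊕ e ⊙ a
  ⊙-distribʳ-⊕ a b e = begin
    (b ⊕ e) ⊙ a      ≡⟨ ⊙-comm (b ⊕ e) a ⟩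
    a ⊙ (b ⊕ e)      ≡⟨ ⊙-distribˡ-⊕ a b e ⟩
    a ⊙ b ⊕ a ⊙ e    ≡⟨ cong₂ _⊕_ (⊙-comm a b) (⊙-comm a e) ⟩
    b ⊙ a ⊕ e ⊙ a    ∎
    where open ≡-Reasoning

  isCommutativeRing : IsCommutativeRing _⊕_ _⊙_ ⊖_ 0A 1A
  isCommutativeRing = record
    { isRing = record
      { +-isAbelianGroup = record
        { isGroup = record
          { isMonoid = record
            { isSemigroup = record
              { isMagma = record { isEquivalence = isEquivalence ; ∙-cong = cong₂ _⊕_ }
              ; assoc = ⊕-assoc }
            ; identity = ⊕-identityˡ , ⊕-identityʳ }
          ; inverse = ⊖-inverseˡ , ⊖-inverseʳ
          ; ⁻¹-cong = cong ⊖_ }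
        ; comm = ⊕-comm }
      ; *-cong = cong₂ _⊙_
      ; *-assoc = ⊙-assoc
      ; *-identity = ⊙-identityˡ , ⊙-identityʳ
      ; distrib = ⊙-distribˡ-⊕ , ⊙-distribʳ-⊕ }
    ; *-comm = ⊙-comm }

  commutativeRing : CommutativeRing 0ℓ 0ℓ
  commutativeRing = record { isCommutativeRing = isCommutativeRing }

  fromℤ : ℤ → A
  fromℤ z = z , 0ℤ

  fromℤ-+ : ∀ i j → fromℤ (i + j) ≡ fromℤ i ⊕ fromℤ j
  fromℤ-+ i j = cong (i + j ,_) (sym (ℤP.+-identityʳ 0ℤ))

  fromℤ-* : ∀ i j → fromℤ (i * j) ≡ fromℤ i ⊙ fromℤ j
  fromℤ-* i j = cong₂ _,_ (first c i j) (second δ i j)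
    where
    first : ∀ c i j → i * j ≡ i * j - c * (0ℤ * 0ℤ)
    first = solve-∀
    second : ∀ d i j → 0ℤ ≡ i * 0ℤ + j * 0ℤ + d * (0ℤ * 0ℤ)
    second = solve-∀

  fromℤ-neg : ∀ i → fromℤ (- i) ≡ ⊖ fromℤ i
  fromℤ-neg i = refl

  private
    ring : ACR.AlmostCommutativeRing 0ℓ 0ℓ
    ring = ACR.fromCommutativeRing commutativeRing

    fromℤ-hom : ℤ.+-*-rawRing ACR.-Raw-AlmostCommutative⟶ ring
    fromℤ-hom = record
      { ⟦_⟧ = fromℤ ; +-homo = fromℤ-+ ; *-homo = fromℤ-* ; -‿homo = fromℤ-neg
      ; 0-homo = refl ; 1-homo = refl }

    fromℤ-≟ : (i j : ℤ) → Maybe (fromℤ i ≡ fromℤ j)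
    fromℤ-≟ i j with i ℤ.≟ j
    ... | yes refl = just refl
    ... | no _     = nothing

  open import Algebra.Solver.Ring ℤ.+-*-rawRing ring fromℤ-hom fromℤ-≟ public
    using (_:=_; _:+_; _:*_; :-_; con) renaming (solve to solveA)

  fromℤ-^ : ∀ i k → fromℤ (i ^ k) ≡ fromℤ i ^A k
  fromℤ-^ i zero    = refl
  fromℤ-^ i (suc k) = trans (fromℤ-* i (i ^ k)) (cong (fromℤ i ⊙_) (fromℤ-^ i k))

  ^A-+ : ∀ a m k → a ^A (m ℕ.+ k) ≡ a ^A m ⊙ a ^A k
  ^A-+ a zero    k = sym (⊙-identityˡ _)
  ^A-+ a (suc m) k = trans (cong (a ⊙_) (^A-+ a m k)) (sym (⊙-assoc a _ _))

  ⊙-zeroʳ : ∀ a → a ⊙ 0A ≡ 0A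
  ⊙-zeroʳ (x , y) = cong₂ _,_ (first c x y) (second δ x y)
    where
    first : ∀ c x y → x * 0ℤ - c * (y * 0ℤ) ≡ 0ℤ
    first = solve-∀
    second : ∀ d x y → x * 0ℤ + 0ℤ * y + d * (y * 0ℤ) ≡ 0ℤ
    second = solve-∀

  ⊙-zeroˡ : ∀ a → 0A ⊙ a ≡ 0A
  ⊙-zeroˡ a = trans (⊙-comm 0A a) (⊙-zeroʳ a)

  ⊖-involutive : ∀ a → ⊖ ⊖ a ≡ a
  ⊖-involutive (x , y) = cong₂ _,_ (ℤP.neg-involutive x) (ℤP.neg-involutive y)

  ⊙-⊖ : ∀ a b → a ⊙ ⊖ b ≡ ⊖ (a ⊙ b)
  ⊙-⊖ = solveA 2 (λ a b → a :* (:- b) := :- (a :* b)) refl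

  conj : A → A
  conj (x , y) = x + δ * y , - y

  norm : A → ℤ
  norm (x , y) = x * x + δ * (x * y) + c * (y * y)

  ⊙-conj : ∀ a → a ⊙ conj a ≡ fromℤ (norm a)
  ⊙-conj (x , y) = cong₂ _,_ (first δ c x y) (second δ x y)
    where
    first : ∀ d c x y → x * (x + d * y) - c * (y * - y) ≡ x * x + d * (x * y) + c * (y * y)
    first = solve-∀
    second : ∀ d x y → x * - y + (x + d * y) * y + d * (y * - y) ≡ 0ℤ
    second = solve-∀

  ⊙-⊖conj : ∀ a → a ⊙ ⊖ conj a ≡ fromℤ (- norm a)
  ⊙-⊖conj a = trans (⊙-⊖ a (conj a)) (cong ⊖_ (⊙-conj a))

  conj-⊙ : ∀ a b → conj (a ⊙ b) ≡ conj a ⊙ conj b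
  conj-⊙ (x₁ , y₁) (x₂ , y₂) = cong₂ _,_ (first δ c x₁ y₁ x₂ y₂) (second δ x₁ y₁ x₂ y₂)
    where
    first : ∀ d c x₁ y₁ x₂ y₂ →
      x₁ * x₂ - c * (y₁ * y₂) + d * (x₁ * y₂ + x₂ * y₁ + d * (y₁ * y₂))
      ≡ (x₁ + d * y₁) * (x₂ + d * y₂) - c * (- y₁ * - y₂)
    first = solve-∀
    second : ∀ d x₁ y₁ x₂ y₂ →
      - (x₁ * y₂ + x₂ * y₁ + d * (y₁ * y₂))
      ≡ (x₁ + d * y₁) * - y₂ + (x₂ + d * y₂) * - y₁ + d * (- y₁ * - y₂)
    second = solve-∀

  conj-involutive : ∀ a → conj (conj a) ≡ a
  conj-involutive (x , y) = cong₂ _,_ (cancel δ x y) (ℤP.neg-involutive y)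
    where
    cancel : ∀ d x y → x + d * y + d * - y ≡ x
    cancel = solve-∀

  norm-⊙ : ∀ a b → norm (a ⊙ b) ≡ norm a * norm b
  norm-⊙ a b = cong proj₁ (begin
    fromℤ (norm (a ⊙ b))              ≡⟨ ⊙-conj (a ⊙ b) ⟨
    a ⊙ b ⊙ conj (a ⊙ b)              ≡⟨ cong (a ⊙ b ⊙_) (conj-⊙ a b) ⟩
    a ⊙ b ⊙ (conj a ⊙ conj b)
      ≡⟨ solveA 4 (λ a b a′ b′ → a :* b :* (a′ :* b′) := a :* a′ :* (b :* b′)) refl a b (conj a) (conj b) ⟩
    a ⊙ conj a ⊙ (b ⊙ conj b)         ≡⟨ cong₂ _⊙_ (⊙-conj a) (⊙-conj b) ⟩
    fromℤ (norm a) ⊙ fromℤ (norm b)   ≡⟨ fromℤ-* (norm a) (norm b) ⟨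
    fromℤ (norm a * norm b)           ∎)
    where open ≡-Reasoning

  norm-conj : ∀ a → norm (conj a) ≡ norm a
  norm-conj a = cong proj₁ (begin
    fromℤ (norm (conj a))       ≡⟨ ⊙-conj (conj a) ⟨
    conj a ⊙ conj (conj a)      ≡⟨ cong (conj a ⊙_) (conj-involutive a) ⟩
    conj a ⊙ a                  ≡⟨ ⊙-comm (conj a) a ⟩
    a ⊙ conj a                  ≡⟨ ⊙-conj a ⟩
    fromℤ (norm a)              ∎)
    where open ≡-Reasoning

  norm-⊖ : ∀ a → norm (⊖ a) ≡ norm a
  norm-⊖ (x , y) = lemma δ c x y
    where
    lemma : ∀ d c x y → - x * - x + d * (- x * - y) + c * (- y * - y) ≡ x * x + d * (x * y) + c * (y * y)
    lemma = solve-∀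

  norm-fromℤ : ∀ i → norm (fromℤ i) ≡ i * i
  norm-fromℤ i = lemma δ c i
    where
    lemma : ∀ d c i → i * i + d * (i * 0ℤ) + c * (0ℤ * 0ℤ) ≡ i * i
    lemma = solve-∀

  infix 4 _∣A_
  record _∣A_ (g x : A) : Set where
    constructor divides
    field
      quotient : A
      equality : x ≡ g ⊙ quotient

  ∣A-refl : ∀ {g} → g ∣A g
  ∣A-refl {g} = divides 1A (sym (⊙-identityʳ g))

  ∣A-⊕ : ∀ {g x y} → g ∣A x → g ∣A y → g ∣A x ⊕ y
  ∣A-⊕ {g} (divides r refl) (divides s refl) = divides (r ⊕ s) (sym (⊙-distribˡ-⊕ g r s))

  ∣A-⊙ : ∀ {g x} r → g ∣A x → g ∣A r ⊙ x
  ∣A-⊙ {g} r (divides s refl) = divides (r ⊙ s) (solveA 3 (λ r g s → r :* (g :* s) := g :* (r :* s)) refl r g s)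

  ∣A-mono : ∀ {g h x y} → g ∣A x → h ∣A y → g ⊙ h ∣A x ⊙ y
  ∣A-mono {g} {h} (divides r refl) (divides s refl) =
    divides (r ⊙ s) (solveA 4 (λ g r h s → g :* r :* (h :* s) := g :* h :* (r :* s)) refl g r h s)

  fromℤ-cancel : ∀ z {x y} → z ≢ 0ℤ → fromℤ z ⊙ x ≡ fromℤ z ⊙ y → x ≡ y
  fromℤ-cancel z {x₁ , y₁} {x₂ , y₂} z≢0 eq = cong₂ _,_
    (ℤP.*-cancelˡ-≡ z x₁ x₂ {{ℤ.≢-nonZero z≢0}} (trans (sym (first c z x₁ y₁)) (trans (cong proj₁ eq) (first c z x₂ y₂))))
    (ℤP.*-cancelˡ-≡ z y₁ y₂ {{ℤ.≢-nonZero z≢0}} (trans (sym (second δ z x₁ y₁)) (trans (cong proj₂ eq) (second δ z x₂ y₂))))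
    where
    first : ∀ c z x y → z * x - c * (0ℤ * y) ≡ z * x
    first = solve-∀
    second : ∀ d z x y → z * y + x * 0ℤ + d * (0ℤ * y) ≡ z * y
    second = solve-∀

  IsUnit⇒IsUnitℤ-norm : ∀ {u} → IsUnit u → IsUnitℤ (norm u)
  IsUnit⇒IsUnitℤ-norm {u} (v , uv≡1) =
    i*j≡1⇒IsUnitℤ (norm u) (norm v) (trans (sym (norm-⊙ u v)) (trans (cong norm uv≡1) (norm-fromℤ 1ℤ)))

  IsUnitℤ-norm⇒IsUnit : ∀ {u} → IsUnitℤ (norm u) → IsUnit u
  IsUnitℤ-norm⇒IsUnit {u} N±1 = conj u ⊙ fromℤ (norm u) , (begin
    u ⊙ (conj u ⊙ fromℤ (norm u))     ≡⟨ ⊙-assoc u (conj u) (fromℤ (norm u)) ⟨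
    u ⊙ conj u ⊙ fromℤ (norm u)       ≡⟨ cong (_⊙ fromℤ (norm u)) (⊙-conj u) ⟩
    fromℤ (norm u) ⊙ fromℤ (norm u)   ≡⟨ fromℤ-* (norm u) (norm u) ⟨
    fromℤ (norm u * norm u)           ≡⟨ cong fromℤ (IsUnitℤ⇒i*i≡1 N±1) ⟩
    1A                                ∎)
    where open ≡-Reasoning

  coord₂-⊙ : ∀ a b → + 2 * coord₂ (a ⊙ b) ≡ coord₁ a * coord₂ b + coord₂ a * coord₁ b
  coord₂-⊙ (x₁ , y₁) (x₂ , y₂) = lemma δ x₁ y₁ x₂ y₂
    where
    lemma : ∀ d x₁ y₁ x₂ y₂ → + 2 * (x₁ * y₂ + x₂ * y₁ + d * (y₁ * y₂)) ≡ (+ 2 * x₁ + d * y₁) * y₂ + y₁ * (+ 2 * x₂ + d * y₂)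
    lemma = solve-∀

  coord₁-conj : ∀ a → coord₁ (conj a) ≡ coord₁ a
  coord₁-conj (x , y) = lemma δ x y
    where
    lemma : ∀ d x y → + 2 * (x + d * y) + d * - y ≡ + 2 * x + d * y
    lemma = solve-∀

  coord₁-⊖ : ∀ a → coord₁ (⊖ a) ≡ - coord₁ a
  coord₁-⊖ (x , y) = lemma δ x y
    where
    lemma : ∀ d x y → + 2 * - x + d * - y ≡ - (+ 2 * x + d * y)
    lemma = solve-∀

  module Coordinates (4c≡δ²-δ : + 4 * c ≡ δ * δ - δ) where

    coord-norm : ∀ a → coord₁ a * coord₁ a - δ * (coord₂ a * coord₂ a) ≡ + 4 * norm a
    coord-norm (x , y) = begin
      (+ 2 * x + δ * y) * (+ 2 * x + δ * y) - δ * (y * y)         ≡⟨ expand δ x y ⟩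
      + 4 * (x * x) + + 4 * (δ * (x * y)) + (δ * δ - δ) * (y * y)
        ≡⟨ cong (λ t → + 4 * (x * x) + + 4 * (δ * (x * y)) + t * (y * y)) 4c≡δ²-δ ⟨
      + 4 * (x * x) + + 4 * (δ * (x * y)) + + 4 * c * (y * y)      ≡⟨ collect δ c x y ⟩
      + 4 * (x * x + δ * (x * y) + c * (y * y))                    ∎
      where
      open ≡-Reasoning
      expand : ∀ d x y → (+ 2 * x + d * y) * (+ 2 * x + d * y) - d * (y * y)
                         ≡ + 4 * (x * x) + + 4 * (d * (x * y)) + (d * d - d) * (y * y)
      expand = solve-∀
      collect : ∀ d c x y → + 4 * (x * x) + + 4 * (d * (x * y)) + + 4 * c * (y * y)
                            ≡ + 4 * (x * x + d * (x * y) + c * (y * y))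
      collect = solve-∀

    coord₁-⊙ : ∀ a b → + 2 * coord₁ (a ⊙ b) ≡ coord₁ a * coord₁ b + δ * (coord₂ a * coord₂ b)
    coord₁-⊙ (x₁ , y₁) (x₂ , y₂) = begin
      + 2 * (+ 2 * (x₁ * x₂ - c * (y₁ * y₂)) + δ * (x₁ * y₂ + x₂ * y₁ + δ * (y₁ * y₂))) ≡⟨ expand δ c x₁ y₁ x₂ y₂ ⟩
      E (+ 4 * c)                                              ≡⟨ cong E 4c≡δ²-δ ⟩
      E (δ * δ - δ)                                            ≡⟨ collect δ x₁ y₁ x₂ y₂ ⟩
      (+ 2 * x₁ + δ * y₁) * (+ 2 * x₂ + δ * y₂) + δ * (y₁ * y₂) ∎
      where
      open ≡-Reasoning
      E : ℤ → ℤ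
      E t = + 4 * (x₁ * x₂) - t * (y₁ * y₂) + + 2 * δ * (x₁ * y₂ + x₂ * y₁) + + 2 * (δ * δ) * (y₁ * y₂)
      expand : ∀ d c x₁ y₁ x₂ y₂ →
        + 2 * (+ 2 * (x₁ * x₂ - c * (y₁ * y₂)) + d * (x₁ * y₂ + x₂ * y₁ + d * (y₁ * y₂)))
        ≡ + 4 * (x₁ * x₂) - + 4 * c * (y₁ * y₂) + + 2 * d * (x₁ * y₂ + x₂ * y₁) + + 2 * (d * d) * (y₁ * y₂)
      expand = solve-∀
      collect : ∀ d x₁ y₁ x₂ y₂ →
        + 4 * (x₁ * x₂) - (d * d - d) * (y₁ * y₂) + + 2 * d * (x₁ * y₂ + x₂ * y₁) + + 2 * (d * d) * (y₁ * y₂)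
        ≡ (+ 2 * x₁ + d * y₁) * (+ 2 * x₂ + d * y₂) + d * (y₁ * y₂)
      collect = solve-∀

  module _ {P Q : Pred A 0ℓ} where

    ·-⊕ : ∀ {x y} → x ∈ P · Q → y ∈ P · Q → x ⊕ y ∈ P · Q
    ·-⊕ {y = y} sp-nil y∈PQ = subst (_∈ P · Q) (sym (⊕-identityˡ y)) y∈PQ
    ·-⊕ {y = y} (sp-cons {s} i j i∈P j∈Q s∈PQ) y∈PQ =
      subst (_∈ P · Q) (sym (⊕-assoc (i ⊙ j) s y)) (sp-cons i j i∈P j∈Q (·-⊕ s∈PQ y∈PQ))

    ·-⊙ : (∀ r {i} → i ∈ P → r ⊙ i ∈ P) → ∀ r {x} → x ∈ P · Q → r ⊙ x ∈ P · Q
    ·-⊙ P-⊙ r sp-nil = subst (_∈ P · Q) (sym (⊙-zeroʳ r)) sp-nil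
    ·-⊙ P-⊙ r (sp-cons {s} i j i∈P j∈Q s∈PQ) =
      subst (_∈ P · Q) (sym (trans (⊙-distribˡ-⊕ r (i ⊙ j) s) (cong (_⊕ r ⊙ s) (sym (⊙-assoc r i j)))))
        (sp-cons (r ⊙ i) j (P-⊙ r i∈P) j∈Q (·-⊙ P-⊙ r s∈PQ))

    ⊙-∈· : ∀ {i j} → i ∈ P → j ∈ Q → i ⊙ j ∈ P · Q
    ⊙-∈· {i} {j} i∈P j∈Q = subst (_∈ P · Q) (⊕-identityʳ (i ⊙ j)) (sp-cons i j i∈P j∈Q sp-nil)

    ·-least : ∀ {K : Pred A 0ℓ} → 0A ∈ K → (∀ {x y} → x ∈ K → y ∈ K → x ⊕ y ∈ K) →
              (∀ {i j} → i ∈ P → j ∈ Q → i ⊙ j ∈ K) → P · Q ⊆ K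
    ·-least 0∈K K-⊕ PQ⊆K sp-nil = 0∈K
    ·-least 0∈K K-⊕ PQ⊆K (sp-cons i j i∈P j∈Q s∈PQ) = K-⊕ (PQ⊆K i∈P j∈Q) (·-least 0∈K K-⊕ PQ⊆K s∈PQ)

module IdealPowers (δ : ℤ) where
  open QuadraticInteger δ

  module _ {n : ℕ} {b : ℤ} {μ R S : A} (b≢0 : b ≢ 0ℤ) (μμ̄≡bⁿ : μ ⊙ conj μ ≡ fromℤ b ^A n)
           (1∈⟨μ,μ̄⟩ : 1A ≡ R ⊙ μ ⊕ S ⊙ conj μ) where
    open ≡-Reasoning

    μ̄ : A
    μ̄ = conj μ

    b^ : ℕ → A
    b^ k = fromℤ b ^A k

    b^-+ : ∀ j k → b^ (j ℕ.+ k) ≡ b^ j ⊙ b^ k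
    b^-+ = ^A-+ (fromℤ b)

    b^-∸ : ∀ {j k} → k ℕ.≤ j → b^ j ≡ b^ (j ℕ.∸ k) ⊙ b^ k
    b^-∸ {j} {k} k≤j = trans (cong b^ (sym (ℕP.m∸n+n≡m k≤j))) (b^-+ (j ℕ.∸ k) k)

    b^-cancel : ∀ k {x y} → b^ k ⊙ x ≡ b^ k ⊙ y → x ≡ y
    b^-cancel k {x} {y} eq = fromℤ-cancel (b ^ k) (b≢0 ∘ ℤP.i^n≡0⇒i≡0 b k)
      (trans (cong (_⊙ x) (fromℤ-^ b k)) (trans eq (cong (_⊙ y) (sym (fromℤ-^ b k)))))

    record ⟨b^_,μ⟩ (k : ℕ) (x : A) : Set where
      constructor spanned
      field
        r s : A
        equality : x ≡ r ⊙ b^ k ⊕ s ⊙ μ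

    0A∈⟨b^,μ⟩ : ∀ {k} → 0A ∈ ⟨b^ k ,μ⟩
    0A∈⟨b^,μ⟩ {k} = spanned 0A 0A (sym (trans (cong₂ _⊕_ (⊙-zeroˡ (b^ k)) (⊙-zeroˡ μ)) (⊕-identityˡ 0A)))

    ⟨b^,μ⟩-⊕ : ∀ {k x y} → x ∈ ⟨b^ k ,μ⟩ → y ∈ ⟨b^ k ,μ⟩ → x ⊕ y ∈ ⟨b^ k ,μ⟩
    ⟨b^,μ⟩-⊕ {k} (spanned r s refl) (spanned r′ s′ refl) = spanned (r ⊕ r′) (s ⊕ s′)
      (solveA 6 (λ r s r′ s′ B M → r :* B :+ s :* M :+ (r′ :* B :+ s′ :* M) := (r :+ r′) :* B :+ (s :+ s′) :* M)
        refl r s r′ s′ (b^ k) μ)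

    ⟨b^,μ⟩-⊙ : ∀ {k x} t → x ∈ ⟨b^ k ,μ⟩ → t ⊙ x ∈ ⟨b^ k ,μ⟩
    ⟨b^,μ⟩-⊙ {k} t (spanned r s refl) = spanned (t ⊙ r) (t ⊙ s)
      (solveA 5 (λ t r s B M → t :* (r :* B :+ s :* M) := t :* r :* B :+ t :* s :* M) refl t r s (b^ k) μ)

    b^∈⟨b^,μ⟩ : ∀ {k j} → k ℕ.≤ j → b^ j ∈ ⟨b^ k ,μ⟩
    b^∈⟨b^,μ⟩ {k} {j} k≤j = spanned (b^ (j ℕ.∸ k)) 0A
      (trans (b^-∸ k≤j) (sym (trans (cong (b^ (j ℕ.∸ k) ⊙ b^ k ⊕_) (⊙-zeroˡ μ)) (⊕-identityʳ _))))

    μ∈⟨b^,μ⟩ : ∀ {k} → μ ∈ ⟨b^ k ,μ⟩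
    μ∈⟨b^,μ⟩ {k} = spanned 0A 1A (sym (trans (cong₂ _⊕_ (⊙-zeroˡ (b^ k)) (⊙-identityˡ μ)) (⊕-identityˡ μ)))

    ⟨b^,μ⟩-· : ∀ {j k x y} → x ∈ ⟨b^ j ,μ⟩ → y ∈ ⟨b^ k ,μ⟩ → x ⊙ y ∈ ⟨b^ j ℕ.+ k ,μ⟩
    ⟨b^,μ⟩-· {j} {k} (spanned r s refl) (spanned r′ s′ refl) =
      spanned (r ⊙ r′) (r ⊙ s′ ⊙ b^ j ⊕ s ⊙ (r′ ⊙ b^ k ⊕ s′ ⊙ μ)) (begin
      (r ⊙ b^ j ⊕ s ⊙ μ) ⊙ (r′ ⊙ b^ k ⊕ s′ ⊙ μ)
        ≡⟨ solveA 7 (λ r s r′ s′ B B′ M → (r :* B :+ s :* M) :* (r′ :* B′ :+ s′ :* M)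
                       := r :* r′ :* (B :* B′) :+ (r :* s′ :* B :+ s :* (r′ :* B′ :+ s′ :* M)) :* M)
             refl r s r′ s′ (b^ j) (b^ k) μ ⟩
      r ⊙ r′ ⊙ (b^ j ⊙ b^ k) ⊕ t ⊙ μ   ≡⟨ cong (λ w → r ⊙ r′ ⊙ w ⊕ t ⊙ μ) (b^-+ j k) ⟨
      r ⊙ r′ ⊙ b^ (j ℕ.+ k) ⊕ t ⊙ μ   ∎)
      where
      t : A
      t = r ⊙ s′ ⊙ b^ j ⊕ s ⊙ (r′ ⊙ b^ k ⊕ s′ ⊙ μ)

    ⟨b^,μ⟩-antitone : ∀ {k k′} → k ℕ.≤ k′ → ⟨b^ k′ ,μ⟩ ⊆ ⟨b^ k ,μ⟩
    ⟨b^,μ⟩-antitone k≤k′ (spanned r s refl) = ⟨b^,μ⟩-⊕ (⟨b^,μ⟩-⊙ r (b^∈⟨b^,μ⟩ k≤k′)) (⟨b^,μ⟩-⊙ s μ∈⟨b^,μ⟩)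

    ∈⟨b^,μ⟩⇒b^∣⊙μ̄ : ∀ {k x} → k ℕ.≤ n → x ∈ ⟨b^ k ,μ⟩ → b^ k ∣A x ⊙ μ̄
    ∈⟨b^,μ⟩⇒b^∣⊙μ̄ {k} k≤n (spanned r s refl) = divides (r ⊙ μ̄ ⊕ s ⊙ b^ (n ℕ.∸ k)) (begin
      (r ⊙ b^ k ⊕ s ⊙ μ) ⊙ μ̄
        ≡⟨ solveA 5 (λ r B s M M̄ → (r :* B :+ s :* M) :* M̄ := B :* (r :* M̄) :+ s :* (M :* M̄)) refl r (b^ k) s μ μ̄ ⟩
      b^ k ⊙ (r ⊙ μ̄) ⊕ s ⊙ (μ ⊙ μ̄)
        ≡⟨ cong (λ t → b^ k ⊙ (r ⊙ μ̄) ⊕ s ⊙ t) (trans μμ̄≡bⁿ (b^-∸ k≤n)) ⟩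
      b^ k ⊙ (r ⊙ μ̄) ⊕ s ⊙ (b^ (n ℕ.∸ k) ⊙ b^ k)
        ≡⟨ solveA 5 (λ B r M̄ s C → B :* (r :* M̄) :+ s :* (C :* B) := B :* (r :* M̄ :+ s :* C))
                 refl (b^ k) r μ̄ s (b^ (n ℕ.∸ k)) ⟩
      b^ k ⊙ (r ⊙ μ̄ ⊕ s ⊙ b^ (n ℕ.∸ k)) ∎)

    -- this converse is where the coprimality of μ and μ̄ enters
    b^∣⊙μ̄⇒∈⟨b^,μ⟩ : ∀ {k x} → b^ k ∣A x ⊙ μ̄ → x ∈ ⟨b^ k ,μ⟩
    b^∣⊙μ̄⇒∈⟨b^,μ⟩ {k} {x} (divides t xμ̄≡b^t) = spanned (S ⊙ t) (x ⊙ R) (begin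
      x                             ≡⟨ ⊙-identityʳ x ⟨
      x ⊙ 1A                        ≡⟨ cong (x ⊙_) 1∈⟨μ,μ̄⟩ ⟩
      x ⊙ (R ⊙ μ ⊕ S ⊙ μ̄)
        ≡⟨ solveA 5 (λ x R M S M̄ → x :* (R :* M :+ S :* M̄) := S :* (x :* M̄) :+ x :* R :* M) refl x R μ S μ̄ ⟩
      S ⊙ (x ⊙ μ̄) ⊕ x ⊙ R ⊙ μ       ≡⟨ cong (λ w → S ⊙ w ⊕ x ⊙ R ⊙ μ) xμ̄≡b^t ⟩
      S ⊙ (b^ k ⊙ t) ⊕ x ⊙ R ⊙ μ
        ≡⟨ cong (_⊕ x ⊙ R ⊙ μ) (solveA 3 (λ S B t → S :* (B :* t) := S :* t :* B) refl S (b^ k) t) ⟩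
      S ⊙ t ⊙ b^ k ⊕ x ⊙ R ⊙ μ ∎)

    μ∈⟨μ²,bⁿ⟩ : μ ≡ R ⊙ (μ ⊙ μ) ⊕ S ⊙ b^ n
    μ∈⟨μ²,bⁿ⟩ = begin
      μ                         ≡⟨ ⊙-identityʳ μ ⟨
      μ ⊙ 1A                    ≡⟨ cong (μ ⊙_) 1∈⟨μ,μ̄⟩ ⟩
      μ ⊙ (R ⊙ μ ⊕ S ⊙ μ̄)
        ≡⟨ solveA 4 (λ M R S M̄ → M :* (R :* M :+ S :* M̄) := R :* (M :* M) :+ S :* (M :* M̄)) refl μ R S μ̄ ⟩
      R ⊙ (μ ⊙ μ) ⊕ S ⊙ (μ ⊙ μ̄) ≡⟨ cong (λ w → R ⊙ (μ ⊙ μ) ⊕ S ⊙ w) μμ̄≡bⁿ ⟩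
      R ⊙ (μ ⊙ μ) ⊕ S ⊙ b^ n    ∎

    ∣b^-cancel : ∀ {g k x y} → g ∣A b^ k → g ⊙ x ≡ g ⊙ y → x ≡ y
    ∣b^-cancel {g} {k} {x} {y} (divides w b^≡gw) gx≡gy = b^-cancel k (begin
      b^ k ⊙ x      ≡⟨ cong (_⊙ x) b^≡gw ⟩
      g ⊙ w ⊙ x     ≡⟨ solveA 3 (λ g w x → g :* w :* x := w :* (g :* x)) refl g w x ⟩
      w ⊙ (g ⊙ x)   ≡⟨ cong (w ⊙_) gx≡gy ⟩
      w ⊙ (g ⊙ y)   ≡⟨ solveA 3 (λ g w y → w :* (g :* y) := g :* w :* y) refl g w y ⟩
      g ⊙ w ⊙ y     ≡⟨ cong (_⊙ y) b^≡gw ⟨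
      b^ k ⊙ y      ∎)

    Generates : ℕ → A → Set
    Generates k g = ∀ x → x ∈ ⟨b^ k ,μ⟩ ⇔ g ∣A x

    Principal : ℕ → Set
    Principal k = Σ A (Generates k)

    module _ {k : ℕ} {g : A} (gen : Generates k g) where

      generator-∣ : ∀ {x} → x ∈ ⟨b^ k ,μ⟩ → g ∣A x
      generator-∣ = Equivalence.to (gen _)

      generator-∈ : g ∈ ⟨b^ k ,μ⟩
      generator-∈ = Equivalence.from (gen g) ∣A-refl

      generator-∣b^ : g ∣A b^ k
      generator-∣b^ = generator-∣ (b^∈⟨b^,μ⟩ ℕP.≤-refl)

    μ-generates-n : Generates n μ
    μ-generates-n x = mk⇔ to from
      where
      to : x ∈ ⟨b^ n ,μ⟩ → μ ∣A x
      to (spanned r s refl) = divides (r ⊙ μ̄ ⊕ s) (begin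
        r ⊙ b^ n ⊕ s ⊙ μ         ≡⟨ cong (λ w → r ⊙ w ⊕ s ⊙ μ) μμ̄≡bⁿ ⟨
        r ⊙ (μ ⊙ μ̄) ⊕ s ⊙ μ
          ≡⟨ solveA 4 (λ r M M̄ s → r :* (M :* M̄) :+ s :* M := M :* (r :* M̄ :+ s)) refl r μ μ̄ s ⟩
        μ ⊙ (r ⊙ μ̄ ⊕ s)          ∎)
      from : μ ∣A x → x ∈ ⟨b^ n ,μ⟩
      from (divides t refl) = subst (_∈ ⟨b^ n ,μ⟩) (⊙-comm t μ) (⟨b^,μ⟩-⊙ t μ∈⟨b^,μ⟩)

    1A-generates-0 : Generates 0 1A
    1A-generates-0 x = mk⇔ (λ _ → divides x (sym (⊙-identityˡ x)))
                           (λ _ → b^∣⊙μ̄⇒∈⟨b^,μ⟩ (divides (x ⊙ μ̄) (sym (⊙-identityˡ (x ⊙ μ̄)))))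

    generates-+ : ∀ {j k g h} → j ℕ.+ k ℕ.≤ n → Generates j g → Generates k h → Generates (j ℕ.+ k) (g ⊙ h)
    generates-+ {j} {k} {g} {h} j+k≤n gen-g gen-h x = mk⇔ to from
      where
      k≤n∸j : k ℕ.≤ n ℕ.∸ j
      k≤n∸j = subst (ℕ._≤ n ℕ.∸ j) (ℕP.m+n∸m≡n j k) (ℕP.∸-monoˡ-≤ j j+k≤n)
      gh∣b^[j+k] : g ⊙ h ∣A b^ (j ℕ.+ k)
      gh∣b^[j+k] = subst (g ⊙ h ∣A_) (sym (b^-+ j k)) (∣A-mono (generator-∣b^ gen-g) (generator-∣b^ gen-h))
      gh∣b^n : g ⊙ h ∣A b^ n
      gh∣b^n = subst (g ⊙ h ∣A_) (trans (sym (b^-+ j (n ℕ.∸ j))) (cong b^ (ℕP.m+[n∸m]≡n (ℕP.≤-trans (ℕP.m≤m+n j k) j+k≤n))))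
        (∣A-mono (generator-∣b^ gen-g) (generator-∣ gen-h (b^∈⟨b^,μ⟩ k≤n∸j)))
      gh∣μ : g ⊙ h ∣A μ
      gh∣μ = subst (g ⊙ h ∣A_) (sym μ∈⟨μ²,bⁿ⟩)
        (∣A-⊕ (∣A-⊙ R (∣A-mono (generator-∣ gen-g μ∈⟨b^,μ⟩) (generator-∣ gen-h μ∈⟨b^,μ⟩))) (∣A-⊙ S gh∣b^n))
      to : x ∈ ⟨b^ j ℕ.+ k ,μ⟩ → g ⊙ h ∣A x
      to (spanned r s refl) = ∣A-⊕ (∣A-⊙ r gh∣b^[j+k]) (∣A-⊙ s gh∣μ)
      from : g ⊙ h ∣A x → x ∈ ⟨b^ j ℕ.+ k ,μ⟩
      from (divides t refl) = subst (_∈ ⟨b^ j ℕ.+ k ,μ⟩) (⊙-comm t (g ⊙ h))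
        (⟨b^,μ⟩-⊙ t (⟨b^,μ⟩-· (generator-∈ gen-g) (generator-∈ gen-h)))

    generates-* : ∀ q {k γ} → q ℕ.* k ℕ.≤ n → Generates k γ → Generates (q ℕ.* k) (γ ^A q)
    generates-* zero    _ _ = 1A-generates-0
    generates-* (suc q) {k} qk≤n gen =
      generates-+ qk≤n gen (generates-* q (ℕP.≤-trans (ℕP.m≤n+m (q ℕ.* k) k) qk≤n) gen)

    -- the generator of (bᵏ, μ) is γ / g
    principal-∸ : ∀ {j k g γ} → j ℕ.+ k ℕ.≤ n → Generates j g → Generates (j ℕ.+ k) γ → Principal k
    principal-∸ {j} {k} {g} {γ} j+k≤n gen-g gen-γ
      with generator-∣ gen-g (⟨b^,μ⟩-antitone (ℕP.m≤m+n j k) (generator-∈ gen-γ))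
         | generator-∣b^ gen-g
         | ∈⟨b^,μ⟩⇒b^∣⊙μ̄ j+k≤n (generator-∈ gen-γ)
    ... | divides z γ≡gz | divides w b^j≡gw | divides t γμ̄≡b^t = z , gen-z
      where
      zμ̄≡b^wt : z ⊙ μ̄ ≡ b^ k ⊙ (w ⊙ t)
      zμ̄≡b^wt = b^-cancel j (begin
        b^ j ⊙ (z ⊙ μ̄)             ≡⟨ cong (_⊙ (z ⊙ μ̄)) b^j≡gw ⟩
        g ⊙ w ⊙ (z ⊙ μ̄)            ≡⟨ solveA 4 (λ g w z M̄ → g :* w :* (z :* M̄) := w :* (g :* z :* M̄)) refl g w z μ̄ ⟩
        w ⊙ (g ⊙ z ⊙ μ̄)            ≡⟨ cong (λ v → w ⊙ (v ⊙ μ̄)) γ≡gz ⟨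
        w ⊙ (γ ⊙ μ̄)                ≡⟨ cong (w ⊙_) γμ̄≡b^t ⟩
        w ⊙ (b^ (j ℕ.+ k) ⊙ t)     ≡⟨ cong (λ v → w ⊙ (v ⊙ t)) (b^-+ j k) ⟩
        w ⊙ (b^ j ⊙ b^ k ⊙ t)
          ≡⟨ solveA 4 (λ w B B′ t → w :* (B :* B′ :* t) := B :* (B′ :* (w :* t))) refl w (b^ j) (b^ k) t ⟩
        b^ j ⊙ (b^ k ⊙ (w ⊙ t))    ∎)
      z∈ : z ∈ ⟨b^ k ,μ⟩
      z∈ = b^∣⊙μ̄⇒∈⟨b^,μ⟩ (divides (w ⊙ t) zμ̄≡b^wt)
      gen-z : Generates k z
      gen-z x = mk⇔ to from
        where
        to : x ∈ ⟨b^ k ,μ⟩ → z ∣A x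
        to x∈ with generator-∣ gen-γ (⟨b^,μ⟩-· (generator-∈ gen-g) x∈)
        ... | divides r gx≡γr = divides r (∣b^-cancel (generator-∣b^ gen-g)
              (trans gx≡γr (trans (cong (_⊙ r) γ≡gz) (⊙-assoc g z r))))
        from : z ∣A x → x ∈ ⟨b^ k ,μ⟩
        from (divides r refl) = subst (_∈ ⟨b^ k ,μ⟩) (⊙-comm r z) (⟨b^,μ⟩-⊙ r z∈)

    generators-associated : ∀ {k g h} → Generates k g → Generates k h → Σ A λ r → h ≡ g ⊙ r × IsUnit r
    generators-associated {k} {g} {h} gen-g gen-h
      with generator-∣ gen-g (generator-∈ gen-h) | generator-∣ gen-h (generator-∈ gen-g)
    ... | divides r h≡gr | divides r′ g≡hr′ = r , h≡gr , r′ , ∣b^-cancel (generator-∣b^ gen-g) (begin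
      g ⊙ (r ⊙ r′)   ≡⟨ ⊙-assoc g r r′ ⟨
      g ⊙ r ⊙ r′     ≡⟨ cong (_⊙ r′) h≡gr ⟨
      h ⊙ r′         ≡⟨ g≡hr′ ⟨
      g              ≡⟨ ⊙-identityʳ g ⟨
      g ⊙ 1A         ∎)

    principal-∸-closed : ∀ {x y} → x ℕ.≤ y → y ℕ.≤ n → Principal x → Principal y → Principal (y ℕ.∸ x)
    principal-∸-closed {x} {y} x≤y y≤n (g , gen-g) (γ , gen-γ) =
      principal-∸ (subst (ℕ._≤ n) (sym x+[y∸x]≡y) y≤n) gen-g (subst (λ k → Generates k γ) (sym x+[y∸x]≡y) gen-γ)
      where
      x+[y∸x]≡y : x ℕ.+ (y ℕ.∸ x) ≡ y
      x+[y∸x]≡y = ℕP.m+[n∸m]≡n x≤y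

    principal⇒principal-proper-divisor : ∀ {d} → 0 ℕ.< d → d ℕ.< n → Principal d →
                                          Σ ℕ λ g → g ℕ.< n × g ∣ℕ n × Principal g
    principal⇒principal-proper-divisor {d} 0<d d<n principal-d
      with ∸-closed⇒common-divisor P-∸ (<-wellFounded (d ℕ.+ n)) 0<d (ℕP.<-trans 0<d d<n)
             (ℕP.<⇒≤ d<n , principal-d) (ℕP.≤-refl , μ , μ-generates-n)
      where
      P : ℕ → Set
      P k = k ℕ.≤ n × Principal k
      P-∸ : ∀ {x y} → x ℕ.≤ y → P x → P y → P (y ℕ.∸ x)
      P-∸ {x} {y} x≤y (_ , px) (y≤n , py) = ℕP.≤-trans (ℕP.m∸n≤m y x) y≤n , principal-∸-closed x≤y y≤n px py
    ... | g , 0<g , g∣d , g∣n , _ , principal-g =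
      g , ℕP.≤-<-trans (ℕD.∣⇒≤ {{ℕ.>-nonZero 0<d}} g∣d) d<n , g∣n , principal-g

    generator-power-associated : ∀ q {g γ} → n ≡ q ℕ.* g → Generates g γ → Σ A λ r → μ ≡ γ ^A q ⊙ r × IsUnit r
    generator-power-associated q {g} {γ} n≡qg gen-γ = generators-associated gen-γ^q μ-generates-n
      where
      gen-γ^q : Generates n (γ ^A q)
      gen-γ^q = subst (λ k → Generates k (γ ^A q)) (sym n≡qg) (generates-* q (ℕP.≤-reflexive (sym n≡qg)) gen-γ)

    not-power⇒no-smaller-principal : (∀ {q γ r} → 1 ℕ.< q → q ∣ℕ n → IsUnit r → μ ≢ γ ^A q ⊙ r) →
                                      ∀ {d} → 0 ℕ.< d → d ℕ.< n → ¬ Principal d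
    not-power⇒no-smaller-principal not-power 0<d d<n principal-d =
      refute (principal⇒principal-proper-divisor 0<d d<n principal-d)
      where
      refute : ¬ (Σ ℕ λ g → g ℕ.< n × g ∣ℕ n × Principal g)
      refute (g , g<n , g∣n@(ℕD.divides q n≡qg) , γ , gen-γ) = not-associated (generator-power-associated q n≡qg gen-γ)
        where
        not-associated : ¬ (Σ A λ r → μ ≡ γ ^A q ⊙ r × IsUnit r)
        not-associated (r , μ≡γ^q⊙r , r-unit) = not-power {q} {γ} {r} (ℕD.quotient>1 g∣n g<n) (ℕD.quotient-∣ g∣n) r-unit μ≡γ^q⊙r

    ∈⟨b^0,μ⟩ : ∀ x → x ∈ ⟨b^ 0 ,μ⟩
    ∈⟨b^0,μ⟩ x = spanned x 0A (sym (trans (cong₂ _⊕_ (⊙-identityʳ x) (⊙-zeroˡ μ)) (⊕-identityʳ x)))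

    I : Pred A 0ℓ
    I = ⟨b^ 1 ,μ⟩

    I-⊙ : ∀ t {x} → x ∈ I → t ⊙ x ∈ I
    I-⊙ t = ⟨b^,μ⟩-⊙ t

    b∈I : fromℤ b ∈ I
    b∈I = subst (_∈ I) (⊙-identityʳ (fromℤ b)) (b^∈⟨b^,μ⟩ ℕP.≤-refl)

    I^⊆⟨b^,μ⟩ : ∀ k → I ^I k ⊆ ⟨b^ k ,μ⟩
    I^⊆⟨b^,μ⟩ zero    {x} _ = ∈⟨b^0,μ⟩ x
    I^⊆⟨b^,μ⟩ (suc k) = ·-least 0A∈⟨b^,μ⟩ ⟨b^,μ⟩-⊕ (λ i∈I j∈I^k → ⟨b^,μ⟩-· i∈I (I^⊆⟨b^,μ⟩ k j∈I^k))

    ⟨b^,μ⟩⊆I^ : ∀ k → k ℕ.≤ n → ⟨b^ k ,μ⟩ ⊆ I ^I k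
    ⟨b^,μ⟩⊆I^ zero    _ {x} _ = x
    ⟨b^,μ⟩⊆I^ (suc k) k<n (spanned r s refl) =
      ·-⊕ (·-⊙ I-⊙ r (⊙-∈· b∈I (⟨b^,μ⟩⊆I^ k k≤n (b^∈⟨b^,μ⟩ ℕP.≤-refl))))
          (·-⊙ I-⊙ s (subst (_∈ I · (I ^I k)) (sym μ∈⟨μ²,bⁿ⟩) (·-⊕ (·-⊙ I-⊙ R μ²∈) (·-⊙ I-⊙ S bⁿ∈))))
      where
      k≤n : k ℕ.≤ n
      k≤n = ℕP.<⇒≤ k<n
      μ²∈ : μ ⊙ μ ∈ I · (I ^I k)
      μ²∈ = ⊙-∈· μ∈⟨b^,μ⟩ (⟨b^,μ⟩⊆I^ k k≤n μ∈⟨b^,μ⟩)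
      bⁿ∈ : b^ n ∈ I · (I ^I k)
      bⁿ∈ = subst (_∈ I · (I ^I k)) (sym (b^-∸ k≤n))
        (⊙-∈· (b^∈⟨b^,μ⟩ (ℕP.m<n⇒0<n∸m k<n)) (⟨b^,μ⟩⊆I^ k k≤n (b^∈⟨b^,μ⟩ ℕP.≤-refl)))

    I-isIdeal : IsIdeal I
    I-isIdeal = 0A∈⟨b^,μ⟩ , (λ _ _ → ⟨b^,μ⟩-⊕) , (λ t _ → ⟨b^,μ⟩-⊙ t)

    I-nonZero : NonZeroIdeal I
    I-nonZero = fromℤ b , b∈I , λ b≡0 → b≢0 (cong proj₁ b≡0)

    principal⇒IsPrincipal : ∀ {k} → k ℕ.≤ n → Principal k → IsPrincipal (I ^I k)
    principal⇒IsPrincipal {k} k≤n (g , gen) = g , λ x →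
      (λ x∈I^k → let divides r x≡gr = Equivalence.to (gen x) (I^⊆⟨b^,μ⟩ k x∈I^k) in r , x≡gr) ,
      (λ { (r , x≡gr) → ⟨b^,μ⟩⊆I^ k k≤n (Equivalence.from (gen x) (divides r x≡gr)) })

    IsPrincipal⇒principal : ∀ {k} → k ℕ.≤ n → IsPrincipal (I ^I k) → Principal k
    IsPrincipal⇒principal {k} k≤n (g , gen) = g , λ x → mk⇔
      (λ x∈ → let r , x≡gr = proj₁ (gen x) (⟨b^,μ⟩⊆I^ k k≤n x∈) in divides r x≡gr)
      (λ { (divides r x≡gr) → I^⊆⟨b^,μ⟩ k (proj₂ (gen x) (r , x≡gr)) })

    not-power⇒ClHasElementOfOrder : (∀ {q γ r} → 1 ℕ.< q → q ∣ℕ n → IsUnit r → μ ≢ γ ^A q ⊙ r) →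
                                    ClHasElementOfOrder n
    not-power⇒ClHasElementOfOrder not-power =
      I , I-isIdeal , I-nonZero , principal⇒IsPrincipal ℕP.≤-refl (μ , μ-generates-n) ,
      λ d 0<d d<n → not-power⇒no-smaller-principal not-power 0<d d<n ∘ IsPrincipal⇒principal (ℕP.<⇒≤ d<n)

module Coord₂Divisibility (δ : ℤ) where
  open QuadraticInteger δ

  ∣coord₂-⊙ : ∀ {q a b} → q ∣ˢ coord₂ a → q ∣ˢ coord₂ b → q ∣ˢ coord₂ (a ⊙ b)
  ∣coord₂-⊙ {a = x₁ , y₁} {x₂ , y₂} q∣y₁ q∣y₂ =
    ℤS.∣m∣n⇒∣m+n (ℤS.∣m∣n⇒∣m+n (ℤS.∣n⇒∣m*n x₁ q∣y₂) (ℤS.∣n⇒∣m*n x₂ q∣y₁)) (ℤS.∣n⇒∣m*n δ (ℤS.∣m⇒∣m*n y₂ q∣y₁))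

  ∣coord₂-^A : ∀ {q a} k → q ∣ˢ coord₂ a → q ∣ˢ coord₂ (a ^A k)
  ∣coord₂-^A zero    _      = divides 0ℤ refl
  ∣coord₂-^A {a = a} (suc k) q∣a₂ = ∣coord₂-⊙ {a = a} {a ^A k} q∣a₂ (∣coord₂-^A k q∣a₂)

  module PowerCongruence {q : ℤ} (q∣δ : q ∣ˢ δ) (q∣c : q ∣ˢ c) where

    private
      ⊙-congruence : ∀ x y X Y K xᵏ → q ∣ˢ X - x * xᵏ → q ∣ˢ Y - K * (xᵏ * y) →
                     q ∣ˢ proj₁ ((x , y) ⊙ (X , Y)) - x * (x * xᵏ)
                   × q ∣ˢ proj₂ ((x , y) ⊙ (X , Y)) - (1ℤ + K) * (x * xᵏ * y)
      ⊙-congruence x y X Y K xᵏ q∣X-xxᵏ q∣Y-Kxᵏy =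
        subst (q ∣ˢ_) (sym (first c x y X Y xᵏ)) (ℤS.∣m∣n⇒∣m-n (ℤS.∣n⇒∣m*n x q∣X-xxᵏ) (ℤS.∣m⇒∣m*n (y * Y) q∣c)) ,
        subst (q ∣ˢ_) (sym (second δ x y X Y K xᵏ))
          (ℤS.∣m∣n⇒∣m+n (ℤS.∣m∣n⇒∣m+n (ℤS.∣n⇒∣m*n x q∣Y-Kxᵏy) (ℤS.∣m⇒∣m*n y q∣X-xxᵏ)) (ℤS.∣m⇒∣m*n (y * Y) q∣δ))
        where
        first : ∀ c x y X Y xᵏ → x * X - c * (y * Y) - x * (x * xᵏ) ≡ x * (X - x * xᵏ) - c * (y * Y)
        first = solve-∀
        second : ∀ d x y X Y K xᵏ →
          x * Y + X * y + d * (y * Y) - (1ℤ + K) * (x * xᵏ * y)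
          ≡ x * (Y - K * (xᵏ * y)) + (X - x * xᵏ) * y + d * (y * Y)
        second = solve-∀

    -- (x + y ω)ᵏ⁺¹ ≡ xᵏ⁺¹ + (k + 1) xᵏ y ω modulo q, because q divides both coefficients of ω²
    ^A-suc-congruence : ∀ x y k → q ∣ˢ proj₁ ((x , y) ^A suc k) - x ^ suc k
                                × q ∣ˢ proj₂ ((x , y) ^A suc k) - + suc k * (x ^ k * y)
    ^A-suc-congruence x y zero = divides 0ℤ (first c x y) , divides 0ℤ (second δ x y)
      where
      first : ∀ c x y → x * 1ℤ - c * (y * 0ℤ) - x * 1ℤ ≡ 0ℤ
      first = solve-∀
      second : ∀ d x y → x * 0ℤ + 1ℤ * y + d * (y * 0ℤ) - + 1 * (1ℤ * y) ≡ 0ℤ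
      second = solve-∀
    ^A-suc-congruence x y (suc k) =
      ⊙-congruence x y (proj₁ P) (proj₂ P) (+ suc k) (x ^ k)
        (proj₁ (^A-suc-congruence x y k)) (proj₂ (^A-suc-congruence x y k))
      where
      P : A
      P = (x , y) ^A suc k

  ∣coord₂-^ : ∀ m → + m ∣ˢ δ → + m ∣ˢ c → ∀ γ → + m ∣ˢ coord₂ (γ ^A m)
  ∣coord₂-^ zero    _   _   γ       = divides 0ℤ refl
  ∣coord₂-^ (suc k) m∣δ m∣c (x , y) = ℤS.∣m+n∣n⇒∣m m∣Y-mxᵏy (ℤS.∣m⇒∣-m (ℤS.∣m⇒∣m*n (x ^ k * y) ℤS.∣-refl))
    where
    m∣Y-mxᵏy : + suc k ∣ˢ proj₂ ((x , y) ^A suc k) - + suc k * (x ^ k * y)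
    m∣Y-mxᵏy = proj₂ (PowerCongruence.^A-suc-congruence m∣δ m∣c x y k)

module QuadraticUnits (δ : ℤ) (4c≡δ²-δ : + 4 * Quad.c δ ≡ δ * δ - δ) where
  open QuadraticInteger δ
  open Coordinates 4c≡δ²-δ

  imaginary-unit⇒coord₂≡0 : ∀ {D u} → δ ≡ - + D → 5 ℕ.≤ D → IsUnit u → coord₂ u ≡ 0ℤ
  imaginary-unit⇒coord₂≡0 {D} {u} δ≡-D 5≤D u-unit = ℤP.∣i∣≡0⇒i≡0 (∣u₂∣≡0 (IsUnit⇒IsUnitℤ-norm {u} u-unit))
    where
    u₁ u₂ : ℤ
    u₁ = coord₁ u
    u₂ = coord₂ u
    norm-in-ℕ : + (∣ u₁ ∣ ℕ.* ∣ u₁ ∣ ℕ.+ D ℕ.* (∣ u₂ ∣ ℕ.* ∣ u₂ ∣)) ≡ + 4 * norm u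
    norm-in-ℕ = begin
      + (∣ u₁ ∣ ℕ.* ∣ u₁ ∣ ℕ.+ D ℕ.* (∣ u₂ ∣ ℕ.* ∣ u₂ ∣))     ≡⟨ ℤP.pos-+ (∣ u₁ ∣ ℕ.* ∣ u₁ ∣) (D ℕ.* (∣ u₂ ∣ ℕ.* ∣ u₂ ∣)) ⟩
      + (∣ u₁ ∣ ℕ.* ∣ u₁ ∣) + + (D ℕ.* (∣ u₂ ∣ ℕ.* ∣ u₂ ∣))
        ≡⟨ cong₂ _+_ (i*i≡∣i∣*∣i∣ u₁) (trans (cong (+ D *_) (i*i≡∣i∣*∣i∣ u₂)) (sym (ℤP.pos-* D (∣ u₂ ∣ ℕ.* ∣ u₂ ∣)))) ⟨
      u₁ * u₁ + + D * (u₂ * u₂)                                ≡⟨ neg-neg (u₁ * u₁) (+ D) (u₂ * u₂) ⟩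
      u₁ * u₁ - - + D * (u₂ * u₂)                              ≡⟨ cong (λ d → u₁ * u₁ - d * (u₂ * u₂)) δ≡-D ⟨
      u₁ * u₁ - δ * (u₂ * u₂)                                  ≡⟨ coord-norm u ⟩
      + 4 * norm u                                             ∎
      where
      open ≡-Reasoning
      neg-neg : ∀ a d x → a + d * x ≡ a - - d * x
      neg-neg = solve-∀
    ∣u₂∣≡0 : IsUnitℤ (norm u) → ∣ u₂ ∣ ≡ 0
    ∣u₂∣≡0 (inj₁ N≡1) = m²+D*k²≡4⇒k≡0 {∣ u₁ ∣} 5≤D (ℤP.+-injective (trans norm-in-ℕ (cong (+ 4 *_) N≡1)))
    ∣u₂∣≡0 (inj₂ N≡-1) with () ← trans norm-in-ℕ (cong (+ 4 *_) N≡-1)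

  module Real {D : ℕ} (δ≡D : δ ≡ + D) (5≤D : 5 ℕ.≤ D) where

    -- the units ε = (ε₁ + ε₂ √δ)/2 with ε₁, ε₂ > 0, i.e. the units greater than 1
    record Positive (a : A) : Set where
      constructor positive
      field
        unit     : IsUnitℤ (norm a)
        coord₁>0 : 0ℤ < coord₁ a
        coord₂>0 : 0ℤ < coord₂ a

    Positive? : ∀ a → Dec (Positive a)
    Positive? a = Dec.map′ (λ (u , p₁ , p₂) → positive u p₁ p₂) (λ (positive u p₁ p₂) → u , p₁ , p₂)
      (IsUnitℤ? (norm a) ×-dec (0ℤ ℤ.<? coord₁ a) ×-dec (0ℤ ℤ.<? coord₂ a))

    -- size replaces the real value of a unit in the classical minimality argument
    size : A → ℕ
    size a = ∣ coord₁ a ∣ ℕ.+ ∣ coord₂ a ∣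

    ¬Positive⊖ : ∀ {a} → Positive a → ¬ Positive (⊖ a)
    ¬Positive⊖ {a} (positive _ 0<a₁ _) (positive _ 0<-a₁ _) =
      ℤP.<-asym 0<a₁ (subst (_< 0ℤ) (ℤP.neg-involutive (coord₁ a)) (ℤP.neg-mono-< (subst (0ℤ <_) (coord₁-⊖ a) 0<-a₁)))

    module _ {a b : A} (Pa : Positive a) (Pb : Positive b) where
      open Positive Pa renaming (unit to a-unit; coord₁>0 to 0<a₁; coord₂>0 to 0<a₂)
      open Positive Pb renaming (unit to b-unit; coord₁>0 to 0<b₁; coord₂>0 to 0<b₂)
      private
        a₁ a₂ b₁ b₂ : ℕ
        a₁ = ∣ coord₁ a ∣
        a₂ = ∣ coord₂ a ∣
        b₁ = ∣ coord₁ b ∣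
        b₂ = ∣ coord₂ b ∣

      +2*coord₁-⊙ : + 2 * coord₁ (a ⊙ b) ≡ + (a₁ ℕ.* b₁ ℕ.+ D ℕ.* (a₂ ℕ.* b₂))
      +2*coord₁-⊙ = begin
        + 2 * coord₁ (a ⊙ b)
          ≡⟨ coord₁-⊙ a b ⟩
        coord₁ a * coord₁ b + δ * (coord₂ a * coord₂ b)
          ≡⟨ cong₂ (λ x y → x + δ * y) (cong₂ _*_ (0<i⇒i≡+∣i∣ 0<a₁) (0<i⇒i≡+∣i∣ 0<b₁))
                                       (cong₂ _*_ (0<i⇒i≡+∣i∣ 0<a₂) (0<i⇒i≡+∣i∣ 0<b₂)) ⟩
        + a₁ * + b₁ + δ * (+ a₂ * + b₂)
          ≡⟨ cong (λ d → + a₁ * + b₁ + d * (+ a₂ * + b₂)) δ≡D ⟩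
        + a₁ * + b₁ + + D * (+ a₂ * + b₂)
          ≡⟨ cong₂ _+_ (ℤP.pos-* a₁ b₁) (trans (ℤP.pos-* D (a₂ ℕ.* b₂)) (cong (+ D *_) (ℤP.pos-* a₂ b₂))) ⟨
        + (a₁ ℕ.* b₁) + + (D ℕ.* (a₂ ℕ.* b₂))
          ≡⟨ ℤP.pos-+ (a₁ ℕ.* b₁) (D ℕ.* (a₂ ℕ.* b₂)) ⟨
        + (a₁ ℕ.* b₁ ℕ.+ D ℕ.* (a₂ ℕ.* b₂))
          ∎
        where open ≡-Reasoning

      +2*coord₂-⊙ : + 2 * coord₂ (a ⊙ b) ≡ + (a₁ ℕ.* b₂ ℕ.+ a₂ ℕ.* b₁)
      +2*coord₂-⊙ = begin
        + 2 * coord₂ (a ⊙ b)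
          ≡⟨ coord₂-⊙ a b ⟩
        coord₁ a * coord₂ b + coord₂ a * coord₁ b
          ≡⟨ cong₂ _+_ (cong₂ _*_ (0<i⇒i≡+∣i∣ 0<a₁) (0<i⇒i≡+∣i∣ 0<b₂))
                       (cong₂ _*_ (0<i⇒i≡+∣i∣ 0<a₂) (0<i⇒i≡+∣i∣ 0<b₁)) ⟩
        + a₁ * + b₂ + + a₂ * + b₁
          ≡⟨ cong₂ _+_ (ℤP.pos-* a₁ b₂) (ℤP.pos-* a₂ b₁) ⟨
        + (a₁ ℕ.* b₂) + + (a₂ ℕ.* b₁)
          ≡⟨ ℤP.pos-+ (a₁ ℕ.* b₂) (a₂ ℕ.* b₁) ⟨
        + (a₁ ℕ.* b₂ ℕ.+ a₂ ℕ.* b₁)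
          ∎
        where open ≡-Reasoning

      positive-⊙ : Positive (a ⊙ b)
      positive-⊙ = positive
        (subst IsUnitℤ (sym (norm-⊙ a b)) (*-IsUnitℤ a-unit b-unit))
        (+2*i≡+m⇒0<i +2*coord₁-⊙ (ℕP.<-≤-trans (ℕP.*-mono-≤ (0<i⇒0<∣i∣ 0<a₁) (0<i⇒0<∣i∣ 0<b₁)) (ℕP.m≤m+n _ _)))
        (+2*i≡+m⇒0<i +2*coord₂-⊙ (ℕP.<-≤-trans (ℕP.*-mono-≤ (0<i⇒0<∣i∣ 0<a₁) (0<i⇒0<∣i∣ 0<b₂)) (ℕP.m≤m+n _ _)))

      size-⊙ : size b ℕ.< size (a ⊙ b)
      size-⊙ = ℕP.*-cancelˡ-< 2 (size b) (size (a ⊙ b)) (begin-strict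
        2 ℕ.* (b₁ ℕ.+ b₂)                                               <⟨ growth ⟩
        a₁ ℕ.* b₁ ℕ.+ D ℕ.* (a₂ ℕ.* b₂) ℕ.+ (a₁ ℕ.* b₂ ℕ.+ a₂ ℕ.* b₁)   ≡⟨ cong₂ ℕ._+_ 2c₁≡ 2c₂≡ ⟨
        2 ℕ.* ∣ coord₁ (a ⊙ b) ∣ ℕ.+ 2 ℕ.* ∣ coord₂ (a ⊙ b) ∣
          ≡⟨ ℕP.*-distribˡ-+ 2 ∣ coord₁ (a ⊙ b) ∣ ∣ coord₂ (a ⊙ b) ∣ ⟨
        2 ℕ.* size (a ⊙ b)                                              ∎)
        where
        open ℕP.≤-Reasoning
        growth : 2 ℕ.* (b₁ ℕ.+ b₂) ℕ.< a₁ ℕ.* b₁ ℕ.+ D ℕ.* (a₂ ℕ.* b₂) ℕ.+ (a₁ ℕ.* b₂ ℕ.+ a₂ ℕ.* b₁)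
        growth = 2*[b₁+b₂]<a₁b₁+Da₂b₂+[a₁b₂+a₂b₁] (0<i⇒0<∣i∣ 0<a₁) (0<i⇒0<∣i∣ 0<a₂) (0<i⇒0<∣i∣ 0<b₁) (0<i⇒0<∣i∣ 0<b₂)
                                                (ℕP.≤-trans (s≤s (s≤s z≤n)) 5≤D)
        2c₁≡ : 2 ℕ.* ∣ coord₁ (a ⊙ b) ∣ ≡ a₁ ℕ.* b₁ ℕ.+ D ℕ.* (a₂ ℕ.* b₂)
        2c₁≡ = +2*i≡+m⇒2*∣i∣≡m +2*coord₁-⊙
        2c₂≡ : 2 ℕ.* ∣ coord₂ (a ⊙ b) ∣ ≡ a₁ ℕ.* b₂ ℕ.+ a₂ ℕ.* b₁
        2c₂≡ = +2*i≡+m⇒2*∣i∣≡m +2*coord₂-⊙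

    coord₂≡0⇒±1 : ∀ {u} → IsUnitℤ (norm u) → coord₂ u ≡ 0ℤ → u ≡ 1A ⊎ u ≡ ⊖ 1A
    coord₂≡0⇒±1 {x , y} N±1 refl with i*j≡1⇒IsUnitℤ x x (x*x≡1 (subst IsUnitℤ (norm-on-ℤ δ c x) N±1))
      where
      norm-on-ℤ : ∀ d c x → x * x + d * (x * 0ℤ) + c * (0ℤ * 0ℤ) ≡ x * x
      norm-on-ℤ = solve-∀
      x*x≡1 : IsUnitℤ (x * x) → x * x ≡ 1ℤ
      x*x≡1 (inj₁ x*x≡1) = x*x≡1
      x*x≡1 (inj₂ x*x≡-1) with () ← trans (sym (i*i≡∣i∣*∣i∣ x)) x*x≡-1
    ... | inj₁ refl = inj₁ refl
    ... | inj₂ refl = inj₂ refl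

    coord₁≡0⇒coord₂≡0 : ∀ {u} → IsUnitℤ (norm u) → coord₁ u ≡ 0ℤ → coord₂ u ≡ 0ℤ
    coord₁≡0⇒coord₂≡0 {u} N±1 u₁≡0 = ℤP.∣i∣≡0⇒i≡0 (m²+D*k²≡4⇒k≡0 {0} 5≤D (begin
      D ℕ.* (∣ u₂ ∣ ℕ.* ∣ u₂ ∣)                 ≡⟨ cong (D ℕ.*_) (ℤP.abs-* u₂ u₂) ⟨
      D ℕ.* ∣ u₂ * u₂ ∣                         ≡⟨ ℤP.abs-* (+ D) (u₂ * u₂) ⟨
      ∣ + D * (u₂ * u₂) ∣                        ≡⟨ ℤP.∣-i∣≡∣i∣ (+ D * (u₂ * u₂)) ⟨
      ∣ - (+ D * (u₂ * u₂)) ∣                    ≡⟨ cong ∣_∣ (lemma (coord₁ u) (+ D) (u₂ * u₂) u₁≡0) ⟩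
      ∣ coord₁ u * coord₁ u - + D * (u₂ * u₂) ∣  ≡⟨ cong (λ d → ∣ coord₁ u * coord₁ u - d * (u₂ * u₂) ∣) δ≡D ⟨
      ∣ coord₁ u * coord₁ u - δ * (u₂ * u₂) ∣    ≡⟨ cong ∣_∣ (coord-norm u) ⟩
      ∣ + 4 * norm u ∣                          ≡⟨ ∣4N∣≡4 N±1 ⟩
      4                                         ∎))
      where
      open ≡-Reasoning
      u₂ : ℤ
      u₂ = coord₂ u
      lemma : ∀ x d y → x ≡ 0ℤ → - (d * y) ≡ x * x - d * y
      lemma x d y refl = sym (ℤP.+-identityˡ (- (d * y)))
      ∣4N∣≡4 : ∀ {N} → IsUnitℤ N → ∣ + 4 * N ∣ ≡ 4
      ∣4N∣≡4 (inj₁ refl) = refl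
      ∣4N∣≡4 (inj₂ refl) = refl

    data Associate : Set where
      itself negation conjugate negated-conjugate : Associate

    associate : Associate → A → A
    associate itself            a = a
    associate negation          a = ⊖ a
    associate conjugate         a = conj a
    associate negated-conjugate a = ⊖ conj a

    classify : ∀ {u} → IsUnitℤ (norm u) → (u ≡ 1A ⊎ u ≡ ⊖ 1A) ⊎ Σ Associate λ σ → Positive (associate σ u)
    classify {u} N±1 with ℤP.<-cmp 0ℤ (coord₂ u) | ℤP.<-cmp 0ℤ (coord₁ u)
    ... | tri≈ _ 0≡u₂ _ | _             = inj₁ (coord₂≡0⇒±1 {u} N±1 (sym 0≡u₂))
    ... | tri< _ 0≢u₂ _ | tri≈ _ 0≡u₁ _ = ⊥-elim (0≢u₂ (sym (coord₁≡0⇒coord₂≡0 {u} N±1 (sym 0≡u₁))))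
    ... | tri> _ 0≢u₂ _ | tri≈ _ 0≡u₁ _ = ⊥-elim (0≢u₂ (sym (coord₁≡0⇒coord₂≡0 {u} N±1 (sym 0≡u₁))))
    ... | tri< 0<u₂ _ _ | tri< 0<u₁ _ _ = inj₂ (itself , positive N±1 0<u₁ 0<u₂)
    ... | tri> _ _ u₂<0 | tri> _ _ u₁<0 = inj₂ (negation , positive (subst IsUnitℤ (sym (norm-⊖ u)) N±1)
        (subst (0ℤ <_) (sym (coord₁-⊖ u)) (ℤP.neg-mono-< u₁<0)) (ℤP.neg-mono-< u₂<0))
    ... | tri> _ _ u₂<0 | tri< 0<u₁ _ _ = inj₂ (conjugate , positive (subst IsUnitℤ (sym (norm-conj u)) N±1)
        (subst (0ℤ <_) (sym (coord₁-conj u)) 0<u₁) (ℤP.neg-mono-< u₂<0))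
    ... | tri< 0<u₂ _ _ | tri> _ _ u₁<0 = inj₂ (negated-conjugate , positive
        (subst IsUnitℤ (sym (trans (norm-⊖ (conj u)) (norm-conj u))) N±1)
        (subst (0ℤ <_) (sym (trans (coord₁-⊖ (conj u)) (cong -_ (coord₁-conj u)))) (ℤP.neg-mono-< u₁<0))
        (subst (0ℤ <_) (sym (ℤP.neg-involutive (coord₂ u))) 0<u₂))

    fromCoords : ℕ → ℕ → A
    fromCoords a₁ a₂ = (+ a₁ - δ * + a₂) /ℕ 2 , + a₂

    fromCoords-coords : ∀ {v} → Positive v → fromCoords ∣ coord₁ v ∣ ∣ coord₂ v ∣ ≡ v
    fromCoords-coords {x , y} (positive _ 0<v₁ 0<v₂) =
      cong₂ _,_ (trans (cong (_/ℕ 2) [+∣v₁∣-δ+∣y∣]≡x*2) ([i*d]/ℕd≡i x 2)) (sym (0<i⇒i≡+∣i∣ 0<v₂))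
      where
      cancel : ∀ d x y → + 2 * x + d * y - d * y ≡ x * + 2
      cancel = solve-∀
      [+∣v₁∣-δ+∣y∣]≡x*2 : + ∣ + 2 * x + δ * y ∣ - δ * + ∣ y ∣ ≡ x * + 2
      [+∣v₁∣-δ+∣y∣]≡x*2 = trans (cong₂ (λ v₁ y′ → v₁ - δ * y′) (sym (0<i⇒i≡+∣i∣ 0<v₁)) (sym (0<i⇒i≡+∣i∣ 0<v₂))) (cancel δ x y)

    positive-below? : ∀ M → Dec (Σ A λ v → Positive v × size v ℕ.< M)
    positive-below? M = Dec.map′ found complete
      (ℕP.anyUpTo? (λ a₁ → ℕP.anyUpTo? (λ a₂ → Positive? (fromCoords a₁ a₂) ×-dec size (fromCoords a₁ a₂) ℕ.<? M) M) M)
      where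
      Candidate : ℕ → ℕ → Set
      Candidate a₁ a₂ = Positive (fromCoords a₁ a₂) × size (fromCoords a₁ a₂) ℕ.< M
      found : (Σ ℕ λ a₁ → a₁ ℕ.< M × Σ ℕ λ a₂ → a₂ ℕ.< M × Candidate a₁ a₂) → Σ A λ v → Positive v × size v ℕ.< M
      found (a₁ , _ , a₂ , _ , candidate) = fromCoords a₁ a₂ , candidate
      complete : (Σ A λ v → Positive v × size v ℕ.< M) → Σ ℕ λ a₁ → a₁ ℕ.< M × Σ ℕ λ a₂ → a₂ ℕ.< M × Candidate a₁ a₂
      complete (v , Pv , v<M) =
        ∣ coord₁ v ∣ , ℕP.≤-<-trans (ℕP.m≤m+n _ _) v<M , ∣ coord₂ v ∣ , ℕP.≤-<-trans (ℕP.m≤n+m _ _) v<M ,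
        subst (λ w → Positive w × size w ℕ.< M) (sym (fromCoords-coords {v} Pv)) (Pv , v<M)

    minimal-positive : ∀ {w} → Positive w → Σ A λ ε → Positive ε × (∀ {v} → Positive v → size ε ℕ.≤ size v)
    minimal-positive {w} = descend w (<-wellFounded (size w))
      where
      descend : ∀ w → Acc ℕ._<_ (size w) → Positive w → Σ A λ ε → Positive ε × (∀ {v} → Positive v → size ε ℕ.≤ size v)
      descend w (acc rec) Pw with positive-below? (size w)
      ... | yes (v , Pv , v<w) = descend v (rec v<w) Pv
      ... | no ∄smaller        = w , Pw , λ {v} Pv → ℕP.≮⇒≥ (λ v<w → ∄smaller (v , Pv , v<w))

    module Minimal {ε : A} (Pε : Positive ε) (ε-minimal : ∀ {v} → Positive v → size ε ℕ.≤ size v) where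

      private
        ε⁻¹ : A
        ε⁻¹ = proj₁ (IsUnitℤ-norm⇒IsUnit {ε} (Positive.unit Pε))
        εε⁻¹≡1 : ε ⊙ ε⁻¹ ≡ 1A
        εε⁻¹≡1 = proj₂ (IsUnitℤ-norm⇒IsUnit {ε} (Positive.unit Pε))

      ⊙≢±ε : ∀ {v z s} → Positive v → Positive z → IsUnitℤ s → v ⊙ z ≢ ε ⊙ fromℤ s
      ⊙≢±ε {v} {z} Pv Pz (inj₁ refl) vz≡ε = ℕP.<-irrefl refl (ℕP.<-≤-trans
        (subst (λ w → size v ℕ.< size w) (trans (⊙-comm z v) (trans vz≡ε (⊙-identityʳ ε))) (size-⊙ {z} {v} Pz Pv))
        (ε-minimal Pv))
      ⊙≢±ε {v} {z} Pv Pz (inj₂ refl) vz≡-ε =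
        ¬Positive⊖ {ε} Pε (subst Positive (trans vz≡-ε (trans (⊙-⊖ ε 1A) (cong ⊖_ (⊙-identityʳ ε)))) (positive-⊙ {v} {z} Pv Pz))

      -- v ε⁻¹ is ±1 or has a positive associate, and minimality of ε rules out all cases but ±1 and a
      -- positive v ε⁻¹ of smaller size
      positive⇒power : ∀ {v} → Positive v → Σ ℕ λ k → v ≡ ε ^A k
      positive⇒power {v} = descend v (<-wellFounded (size v))
        where
        descend : ∀ v → Acc ℕ._<_ (size v) → Positive v → Σ ℕ λ k → v ≡ ε ^A k
        descend v (acc rec) Pv = step (classify {w} w-unit)
          where
          w : A
          w = v ⊙ ε⁻¹
          v≡εw : v ≡ ε ⊙ w
          v≡εw = begin
            v                  ≡⟨ ⊙-identityʳ v ⟨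
            v ⊙ 1A             ≡⟨ cong (v ⊙_) εε⁻¹≡1 ⟨
            v ⊙ (ε ⊙ ε⁻¹)      ≡⟨ solveA 3 (λ v e e′ → v :* (e :* e′) := e :* (v :* e′)) refl v ε ε⁻¹ ⟩
            ε ⊙ w              ∎
            where open ≡-Reasoning
          w-unit : IsUnitℤ (norm w)
          w-unit = subst IsUnitℤ (sym (norm-⊙ v ε⁻¹))
            (*-IsUnitℤ (Positive.unit Pv) (IsUnit⇒IsUnitℤ-norm {ε⁻¹} (ε , trans (⊙-comm ε⁻¹ ε) εε⁻¹≡1)))
          vw̄≡εN : v ⊙ conj w ≡ ε ⊙ fromℤ (norm w)
          vw̄≡εN = trans (cong (_⊙ conj w) v≡εw) (trans (⊙-assoc ε w (conj w)) (cong (ε ⊙_) (⊙-conj w)))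
          w<v : Positive w → size w ℕ.< size v
          w<v Pw = subst (λ u → size w ℕ.< size u) (sym v≡εw) (size-⊙ {ε} {w} Pε Pw)
          multiply-by-ε : (Σ ℕ λ k → w ≡ ε ^A k) → Σ ℕ λ k → v ≡ ε ^A k
          multiply-by-ε (k , w≡εᵏ) = suc k , trans v≡εw (cong (ε ⊙_) w≡εᵏ)
          step : (w ≡ 1A ⊎ w ≡ ⊖ 1A) ⊎ Σ Associate (λ σ → Positive (associate σ w)) → Σ ℕ λ k → v ≡ ε ^A k
          step (inj₁ (inj₁ w≡1)) = 1 , trans v≡εw (cong (ε ⊙_) w≡1)
          step (inj₁ (inj₂ w≡-1)) = ⊥-elim (¬Positive⊖ {ε} Pε
            (subst Positive (trans v≡εw (trans (cong (ε ⊙_) w≡-1) (trans (⊙-⊖ ε 1A) (cong ⊖_ (⊙-identityʳ ε))))) Pv))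
          step (inj₂ (itself , Pw)) = multiply-by-ε (descend w (rec (w<v Pw)) Pw)
          step (inj₂ (negation , P⊖w)) =
            ⊥-elim (¬Positive⊖ {v} Pv (subst Positive (trans (⊙-⊖ ε w) (cong ⊖_ (sym v≡εw))) (positive-⊙ {ε} {⊖ w} Pε P⊖w)))
          step (inj₂ (conjugate , Pw̄)) = ⊥-elim (⊙≢±ε {v} {conj w} Pv Pw̄ w-unit vw̄≡εN)
          step (inj₂ (negated-conjugate , P⊖w̄)) = ⊥-elim (⊙≢±ε {v} {⊖ conj w} Pv P⊖w̄ (neg-IsUnitℤ w-unit)
            (trans (⊙-⊖ v (conj w)) (trans (cong ⊖_ vw̄≡εN) (sym (⊙-⊖ ε (fromℤ (norm w)))))))

      isFundamentalUnit : IsFundamentalUnit ε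
      isFundamentalUnit = IsUnitℤ-norm⇒IsUnit {ε} (Positive.unit Pε) , Positive.coord₁>0 Pε , Positive.coord₂>0 Pε ,
        λ u u-unit → decompose (IsUnit⇒IsUnitℤ-norm {u} u-unit) (classify {u} (IsUnit⇒IsUnitℤ-norm {u} u-unit))
        where
        Decomposition : A → ℕ → Set
        Decomposition u k = u ≡ ε ^A k ⊎ u ≡ ⊖ (ε ^A k) ⊎ u ⊙ ε ^A k ≡ 1A ⊎ u ⊙ ε ^A k ≡ ⊖ 1A
        ±1 : ∀ {u e s} → u ⊙ e ≡ fromℤ s → IsUnitℤ s → u ⊙ e ≡ 1A ⊎ u ⊙ e ≡ ⊖ 1A
        ±1 ue≡s (inj₁ refl) = inj₁ ue≡s
        ±1 ue≡s (inj₂ refl) = inj₂ ue≡s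
        via : ∀ {u a} → (∀ {k} → a ≡ ε ^A k → Decomposition u k) → Positive a → Σ ℕ (Decomposition u)
        via decomposition Pa = let k , a≡εᵏ = positive⇒power Pa in k , decomposition a≡εᵏ
        decompose : ∀ {u} → IsUnitℤ (norm u) → (u ≡ 1A ⊎ u ≡ ⊖ 1A) ⊎ Σ Associate (λ σ → Positive (associate σ u)) →
                    Σ ℕ (Decomposition u)
        decompose _ (inj₁ (inj₁ u≡1))  = 0 , inj₁ u≡1
        decompose _ (inj₁ (inj₂ u≡-1)) = 0 , inj₂ (inj₁ u≡-1)
        decompose _ (inj₂ (itself , Pu)) = via inj₁ Pu
        decompose {u} _ (inj₂ (negation , P⊖u)) =
          via (λ ⊖u≡εᵏ → inj₂ (inj₁ (trans (sym (⊖-involutive u)) (cong ⊖_ ⊖u≡εᵏ)))) P⊖u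
        decompose {u} N±1 (inj₂ (conjugate , Pū)) =
          via (λ {k} ū≡εᵏ → inj₂ (inj₂ (±1 {u} {ε ^A k} (trans (cong (u ⊙_) (sym ū≡εᵏ)) (⊙-conj u)) N±1))) Pū
        decompose {u} N±1 (inj₂ (negated-conjugate , P⊖ū)) =
          via (λ {k} ⊖ū≡εᵏ → inj₂ (inj₂ (±1 {u} {ε ^A k} (trans (cong (u ⊙_) (sym ⊖ū≡εᵏ)) (⊙-⊖conj u)) (neg-IsUnitℤ N±1)))) P⊖ū

    ∣coord₂-associate : ∀ {q} σ {a} → q ∣ˢ coord₂ (associate σ a) → q ∣ˢ coord₂ a
    ∣coord₂-associate itself            q∣a₂ = q∣a₂
    ∣coord₂-associate negation          {a} q∣-a₂ = subst (_ ∣ˢ_) (ℤP.neg-involutive (coord₂ a)) (ℤS.∣m⇒∣-m q∣-a₂)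
    ∣coord₂-associate conjugate         {a} q∣-a₂ = subst (_ ∣ˢ_) (ℤP.neg-involutive (coord₂ a)) (ℤS.∣m⇒∣-m q∣-a₂)
    ∣coord₂-associate negated-conjugate {a} q∣a₂ = subst (_ ∣ˢ_) (ℤP.neg-involutive (coord₂ a)) q∣a₂


    module _ {q : ℤ} (q∣ε₂ : ∀ ε → IsFundamentalUnit ε → q ∣ˢ coord₂ ε) where

      ∣coord₂-positive : ∀ {a} → Positive a → q ∣ˢ coord₂ a
      ∣coord₂-positive Pa =
        let ε , Pε , ε-minimal = minimal-positive Pa
            k , a≡εᵏ           = Minimal.positive⇒power Pε ε-minimal Pa
        in subst (λ e → q ∣ˢ coord₂ e) (sym a≡εᵏ)
             (Coord₂Divisibility.∣coord₂-^A δ k (q∣ε₂ ε (Minimal.isFundamentalUnit Pε ε-minimal)))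

      ∣coord₂-unit : ∀ {r} → IsUnit r → q ∣ˢ coord₂ r
      ∣coord₂-unit {r} r-unit = from-classification (classify {r} (IsUnit⇒IsUnitℤ-norm {r} r-unit))
        where
        from-classification : (r ≡ 1A ⊎ r ≡ ⊖ 1A) ⊎ Σ Associate (λ σ → Positive (associate σ r)) → q ∣ˢ coord₂ r
        from-classification (inj₁ (inj₁ r≡1))  = subst (λ e → q ∣ˢ coord₂ e) (sym r≡1) (divides 0ℤ refl)
        from-classification (inj₁ (inj₂ r≡-1)) = subst (λ e → q ∣ˢ coord₂ e) (sym r≡-1) (divides 0ℤ refl)
        from-classification (inj₂ (σ , Pσr))   = ∣coord₂-associate σ (∣coord₂-positive Pσr)

module Discriminant {δ : ℤ} (disc : IsQuadDisc δ) where
  open Quad δ using (c)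

  private
    ∣4m∣ : ∀ {m} → δ ≡ + 4 * m → ∣ δ ∣ ≡ 4 ℕ.* ∣ m ∣
    ∣4m∣ {m} δ≡4m = trans (cong ∣_∣ δ≡4m) (ℤP.abs-* (+ 4) m)
    4*k≡0⇒k≡0 : ∀ {k} → 4 ℕ.* k ≡ 0 → k ≡ 0
    4*k≡0⇒k≡0 {zero} _ = refl

  δ≢0 : δ ≢ 0ℤ
  δ≢0 δ≡0 with proj₂ disc
  ... | inj₁ (δ%4≡1 , _) with () ← trans (cong (_%ℕ 4) (sym δ≡0)) δ%4≡1
  ... | inj₂ (m , δ≡4m , m%4≡2∨3 , _) with ℤP.∣i∣≡0⇒i≡0 {m} (4*k≡0⇒k≡0 (trans (sym (∣4m∣ δ≡4m)) (cong ∣_∣ δ≡0)))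
  ... | refl with m%4≡2∨3
  ...   | inj₁ ()
  ...   | inj₂ ()

  δ≢-1 : δ ≢ -1ℤ
  δ≢-1 δ≡-1 with proj₂ disc
  ... | inj₁ (δ%4≡1 , _) with () ← trans (cong (_%ℕ 4) (sym δ≡-1)) δ%4≡1
  ... | inj₂ (m , δ≡4m , _) = 4*k≢t {∣ m ∣} (s≤s z≤n) (s≤s (s≤s z≤n)) (trans (sym (∣4m∣ δ≡4m)) (cong ∣_∣ δ≡-1))

  δ≢3 : δ ≢ + 3
  δ≢3 δ≡3 with proj₂ disc
  ... | inj₁ (δ%4≡1 , _) with () ← trans (cong (_%ℕ 4) (sym δ≡3)) δ%4≡1
  ... | inj₂ (m , δ≡4m , _) = 4*k≢t {∣ m ∣} (s≤s z≤n) (s≤s (s≤s (s≤s (s≤s z≤n)))) (trans (sym (∣4m∣ δ≡4m)) (cong ∣_∣ δ≡3))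

  4∣δ²-δ : Σ ℤ λ K → δ * δ - δ ≡ K * + 4
  4∣δ²-δ with proj₂ disc
  ... | inj₁ (δ%4≡1 , _) = Q + + 4 * (Q * Q) , trans (cong (λ d → d * d - d) δ≡1+4Q) (expand Q)
    where
    Q : ℤ
    Q = δ /ℕ 4
    δ≡1+4Q : δ ≡ 1ℤ + Q * + 4
    δ≡1+4Q = trans (a≡a%ℕn+[a/ℕn]*n δ 4) (cong (λ r → + r + Q * + 4) δ%4≡1)
    expand : ∀ Q → (1ℤ + Q * + 4) * (1ℤ + Q * + 4) - (1ℤ + Q * + 4) ≡ (Q + + 4 * (Q * Q)) * + 4
    expand = solve-∀
  ... | inj₂ (m , δ≡4m , _) = + 4 * (m * m) - m , trans (cong (λ d → d * d - d) δ≡4m) (expand m)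
    where
    expand : ∀ m → + 4 * m * (+ 4 * m) - + 4 * m ≡ (+ 4 * (m * m) - m) * + 4
    expand = solve-∀

  4c≡δ²-δ : + 4 * c ≡ δ * δ - δ
  4c≡δ²-δ with 4∣δ²-δ
  ... | K , δ²-δ≡K*4 = begin
    + 4 * c                ≡⟨ cong (λ x → + 4 * (x /ℕ 4)) δ²-δ≡K*4 ⟩
    + 4 * ((K * + 4) /ℕ 4) ≡⟨ cong (+ 4 *_) ([i*d]/ℕd≡i K 4) ⟩
    + 4 * K                ≡⟨ ℤP.*-comm (+ 4) K ⟩
    K * + 4                ≡⟨ δ²-δ≡K*4 ⟨
    δ * δ - δ              ∎
    where open ≡-Reasoning

odd∣δ⇒∣c : ∀ {δ} → IsQuadDisc δ → ∀ {q} → ¬ 2 ∣ℕ q → + q ∣ˢ δ → + q ∣ˢ Quad.c δ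
odd∣δ⇒∣c {δ} disc {q} 2∤q q∣δ = ℤS.∣ᵤ⇒∣ (ℕC.coprime-divisor coprime[q,4] q∣4∣c∣)
  where
  coprime[q,4] : ℕC.Coprime q 4
  coprime[q,4] (i∣q , i∣4) = odd∣4⇒≡1 (λ 2∣i → 2∤q (ℕD.∣-trans 2∣i i∣q)) i∣4
  δ[δ-1] : ∀ d → d * (d - 1ℤ) ≡ d * d - d
  δ[δ-1] = solve-∀
  q∣4c : + q ∣ˢ + 4 * Quad.c δ
  q∣4c = subst (+ q ∣ˢ_) (trans (δ[δ-1] δ) (sym (Discriminant.4c≡δ²-δ disc))) (ℤS.∣m⇒∣m*n (δ - 1ℤ) q∣δ)
  q∣4∣c∣ : q ∣ℕ 4 ℕ.* ∣ Quad.c δ ∣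
  q∣4∣c∣ = subst (q ∣ℕ_) (ℤP.abs-* (+ 4) (Quad.c δ)) (ℤS.∣⇒∣ᵤ q∣4c)

unit⇒odd∣coord₂ : ∀ {δ} → IsQuadDisc δ → δ ≢ - + 3 → ∀ {q} → 1 ℕ.< q → ¬ 2 ∣ℕ q → q ∣ℕ ∣ δ ∣ →
                  (0ℤ < δ → ∀ ε → Quad.IsFundamentalUnit δ ε → + q ∣ˢ Quad.coord₂ δ ε) →
                  ∀ {r} → Quad.IsUnit δ r → + q ∣ˢ Quad.coord₂ δ r
unit⇒odd∣coord₂ {δ} disc δ≢-3 {q} 1<q 2∤q q∣δ q∣ε₂ {r} r-unit = by-sign (ℤP.<-cmp 0ℤ δ)
  where
  open Discriminant disc
  ∣δ∣≢3 : ∣ δ ∣ ≢ 3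
  ∣δ∣≢3 ∣δ∣≡3 = [ δ≢3 , δ≢-3 ] (∣i∣≡3⇒i≡±3 ∣δ∣≡3)
  5≤∣δ∣ : 5 ℕ.≤ ∣ δ ∣
  5≤∣δ∣ = odd-divisor⇒5≤ q∣δ 1<q 2∤q (δ≢0 ∘ ℤP.∣i∣≡0⇒i≡0) ∣δ∣≢3
  by-sign : Tri (0ℤ < δ) (0ℤ ≡ δ) (δ < 0ℤ) → + q ∣ˢ Quad.coord₂ δ r
  by-sign (tri< 0<δ _ _) =
    QuadraticUnits.Real.∣coord₂-unit δ 4c≡δ²-δ {∣ δ ∣} (0<i⇒i≡+∣i∣ 0<δ) 5≤∣δ∣ {+ q} (q∣ε₂ 0<δ) {r} r-unit
  by-sign (tri≈ _ 0≡δ _) = ⊥-elim (δ≢0 (sym 0≡δ))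
  by-sign (tri> _ _ δ<0) = subst (+ q ∣ˢ_)
    (sym (QuadraticUnits.imaginary-unit⇒coord₂≡0 δ 4c≡δ²-δ {u = r} (i<0⇒i≡-+∣i∣ δ<0) 5≤∣δ∣ r-unit)) (divides 0ℤ refl)

module Solution (δ : ℤ) (disc : IsQuadDisc δ) (n : ℕ) (n-odd : n ℕ.% 2 ≡ 1) (α β b : ℤ)
  (α²-4bⁿ≡δβ² : α ^ 2 - + 4 * b ^ n ≡ δ * β ^ 2) where
  open QuadraticInteger δ
  open Discriminant disc
  open Coordinates 4c≡δ²-δ
  open ≡-Reasoning

  private
    tα tβ : ℤ
    tα = proj₁ (i[i-1]-even α)
    tβ = proj₁ (i[i-1]-even β)
    i≡j⇒i-j≡0 : ∀ {i j} → i ≡ j → i - j ≡ 0ℤ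
    i≡j⇒i-j≡0 {i} refl = ℤP.+-inverseʳ i

  -- μ = (α + β √δ)/2, whose first coordinate (α - δβ)/2 is written via the halves of α(α - 1) and β(β - 1)
  μ : A
  μ = + 2 * b ^ n - tα + δ * tβ , β

  coord₁-μ : coord₁ μ ≡ α
  coord₁-μ = begin
    + 2 * (+ 2 * b ^ n - tα + δ * tβ) + δ * β
      ≡⟨ rearrange α β δ (b ^ n) tα tβ ⟩
    α - (α ^ 2 - + 4 * b ^ n - δ * β ^ 2) + (α * (α - 1ℤ) - + 2 * tα) - δ * (β * (β - 1ℤ) - + 2 * tβ)
      ≡⟨ cong₂ (λ x y → α - x + y - δ * (β * (β - 1ℤ) - + 2 * tβ))
               (i≡j⇒i-j≡0 α²-4bⁿ≡δβ²) (i≡j⇒i-j≡0 (proj₂ (i[i-1]-even α))) ⟩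
    α - 0ℤ + 0ℤ - δ * (β * (β - 1ℤ) - + 2 * tβ)
      ≡⟨ cong (λ y → α - 0ℤ + 0ℤ - δ * y) (i≡j⇒i-j≡0 (proj₂ (i[i-1]-even β))) ⟩
    α - 0ℤ + 0ℤ - δ * 0ℤ
      ≡⟨ simplify α δ ⟩
    α ∎
    where
    rearrange : ∀ x y d B s t → + 2 * (+ 2 * B - s + d * t) + d * y
      ≡ x - (x * (x * 1ℤ) - + 4 * B - d * (y * (y * 1ℤ))) + (x * (x - 1ℤ) - + 2 * s) - d * (y * (y - 1ℤ) - + 2 * t)
    rearrange = solve-∀
    simplify : ∀ x d → x - 0ℤ + 0ℤ - d * 0ℤ ≡ x
    simplify = solve-∀

  norm-μ : norm μ ≡ b ^ n
  norm-μ = ℤP.*-cancelˡ-≡ (+ 4) (norm μ) (b ^ n) (begin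
    + 4 * norm μ                                  ≡⟨ coord-norm μ ⟨
    coord₁ μ * coord₁ μ - δ * (β * β)             ≡⟨ cong (λ a → a * a - δ * (β * β)) coord₁-μ ⟩
    α * α - δ * (β * β)                           ≡⟨ rearrange α β δ (b ^ n) ⟩
    α ^ 2 - + 4 * b ^ n - δ * β ^ 2 + + 4 * b ^ n ≡⟨ cong (_+ + 4 * b ^ n) (i≡j⇒i-j≡0 α²-4bⁿ≡δβ²) ⟩
    0ℤ + + 4 * b ^ n                              ≡⟨ ℤP.+-identityˡ (+ 4 * b ^ n) ⟩
    + 4 * b ^ n                                   ∎)
    where
    rearrange : ∀ x y d B → x * x - d * (y * y) ≡ x * (x * 1ℤ) - + 4 * B - d * (y * (y * 1ℤ)) + + 4 * B
    rearrange = solve-∀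

  μμ̄≡bⁿ : μ ⊙ conj μ ≡ fromℤ b ^A n
  μμ̄≡bⁿ = trans (⊙-conj μ) (trans (cong fromℤ norm-μ) (fromℤ-^ b n))

  μ⊕μ̄≡α : μ ⊕ conj μ ≡ fromℤ α
  μ⊕μ̄≡α = cong₂ _,_ (trans (trace δ (proj₁ μ) β) coord₁-μ) (ℤP.+-inverseʳ β)
    where
    trace : ∀ d x y → x + (x + d * y) ≡ + 2 * x + d * y
    trace = solve-∀

  1∈⟨μ,μ̄⟩ : gcd b α ≡ 1ℤ → Σ A λ R → Σ A λ S → 1A ≡ R ⊙ μ ⊕ S ⊙ conj μ
  1∈⟨μ,μ̄⟩ gcd[b,α]≡1 with BézoutPair-^ (gcd≡1⇒BézoutPair b α (ℤP.+-injective gcd[b,α]≡1)) n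
  ... | u , v , ubⁿ+vα≡1 = fromℤ u ⊙ conj μ ⊕ fromℤ v , fromℤ v , (begin
    1A                                          ≡⟨ cong fromℤ ubⁿ+vα≡1 ⟨
    fromℤ (u * b ^ n + v * α)                   ≡⟨ fromℤ-+ (u * b ^ n) (v * α) ⟩
    fromℤ (u * b ^ n) ⊕ fromℤ (v * α)           ≡⟨ cong₂ _⊕_ (fromℤ-* u (b ^ n)) (fromℤ-* v α) ⟩
    fromℤ u ⊙ fromℤ (b ^ n) ⊕ fromℤ v ⊙ fromℤ α
      ≡⟨ cong₂ (λ x y → fromℤ u ⊙ x ⊕ fromℤ v ⊙ y) (trans (fromℤ-^ b n) (sym μμ̄≡bⁿ)) (sym μ⊕μ̄≡α) ⟩
    fromℤ u ⊙ (μ ⊙ conj μ) ⊕ fromℤ v ⊙ (μ ⊕ conj μ)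
      ≡⟨ solveA 4 (λ U V M M̄ → U :* (M :* M̄) :+ V :* (M :+ M̄) := (U :* M̄ :+ V) :* M :+ V :* M̄)
               refl (fromℤ u) (fromℤ v) μ (conj μ) ⟩
    (fromℤ u ⊙ conj μ ⊕ fromℤ v) ⊙ μ ⊕ fromℤ v ⊙ conj μ ∎)

  n≢0 : n ≢ 0
  n≢0 n≡0 with () ← trans (cong (ℕ._% 2) (sym n≡0)) n-odd

  b≢0 : gcd b α ≡ 1ℤ → b ≢ 0ℤ
  b≢0 gcd[b,α]≡1 refl = [ proj₁ disc , δ≢-1 ] (i*j≡1⇒IsUnitℤ δ (β ^ 2) (begin
    δ * β ^ 2                 ≡⟨ α²-4bⁿ≡δβ² ⟨
    α ^ 2 - + 4 * 0ℤ ^ n      ≡⟨ cong (λ z → α ^ 2 - + 4 * z) (0^n≡0 n n≢0) ⟩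
    α ^ 2 - + 4 * 0ℤ          ≡⟨ simplify α ⟩
    α * α                     ≡⟨ i*i≡∣i∣*∣i∣ α ⟩
    + (∣ α ∣ ℕ.* ∣ α ∣)       ≡⟨ cong (λ a → + (a ℕ.* a)) ∣α∣≡1 ⟩
    1ℤ                        ∎))
    where
    ∣α∣≡1 : ∣ α ∣ ≡ 1
    ∣α∣≡1 = trans (sym (ℕG.gcd-identityˡ ∣ α ∣)) (ℤP.+-injective gcd[b,α]≡1)
    0^n≡0 : ∀ n → n ≢ 0 → 0ℤ ^ n ≡ 0ℤ
    0^n≡0 zero    n≢0 = ⊥-elim (n≢0 refl)
    0^n≡0 (suc _) _   = refl
    simplify : ∀ x → x * (x * 1ℤ) - + 4 * 0ℤ ≡ x * x
    simplify = solve-∀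

  μ-not-power : δ ≢ - + 3 → (+ n) ∣ δ → (0ℤ < δ → ∀ ε → IsFundamentalUnit ε → (+ n) ∣ coord₂ ε) →
                gcd β (+ n) ≡ 1ℤ → ∀ {q γ r} → 1 ℕ.< q → q ∣ℕ n → IsUnit r → μ ≢ γ ^A q ⊙ r
  μ-not-power δ≢-3 n∣δ n∣ε₂ gcd[β,n]≡1 {q} {γ} {r} 1<q q∣n r-unit μ≡γ^q⊙r = ℕP.<-irrefl (sym q≡1) 1<q
    where
    2∤q : ¬ 2 ∣ℕ q
    2∤q 2∣q with () ← trans (sym (ℕD.n∣m⇒m%n≡0 n 2 (ℕD.∣-trans 2∣q q∣n))) n-odd
    q∣δ : q ∣ℕ ∣ δ ∣
    q∣δ = ℕD.∣-trans q∣n n∣δ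
    q∣ε₂ : 0ℤ < δ → ∀ ε → IsFundamentalUnit ε → + q ∣ˢ coord₂ ε
    q∣ε₂ 0<δ ε ε-fundamental = ℤS.∣ᵤ⇒∣ (ℕD.∣-trans q∣n (n∣ε₂ 0<δ ε ε-fundamental))
    q∣β : + q ∣ˢ β
    q∣β = subst (λ x → + q ∣ˢ coord₂ x) (sym μ≡γ^q⊙r)
      (Coord₂Divisibility.∣coord₂-⊙ δ {a = γ ^A q} {r}
        (Coord₂Divisibility.∣coord₂-^ δ q (ℤS.∣ᵤ⇒∣ q∣δ) (odd∣δ⇒∣c disc 2∤q (ℤS.∣ᵤ⇒∣ q∣δ)) γ)
        (unit⇒odd∣coord₂ disc δ≢-3 1<q 2∤q q∣δ q∣ε₂ {r} r-unit))
    q≡1 : q ≡ 1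
    q≡1 = ℕD.∣1⇒≡1 (subst (λ g → q ∣ℕ ∣ g ∣) gcd[β,n]≡1 (gcd-greatest {β} {+ n} {+ q} (ℤS.∣⇒∣ᵤ q∣β) q∣n))

proposition43 : (δ : ℤ) → IsQuadDisc δ → ¬ (δ ≡ - + 3) →
    (n : ℕ) → n ℕ.% 2 ≡ 1 → (+ n) ∣ δ →
    (0ℤ < δ → ∀ ε → Quad.IsFundamentalUnit δ ε → (+ n) ∣ Quad.coord₂ δ ε) →
    (α β b : ℤ) → α ^ 2 - + 4 * b ^ n ≡ δ * β ^ 2 →
    gcd b α ≡ 1ℤ → gcd β (+ n) ≡ 1ℤ → gcd α (+ n) ≡ 1ℤ →
    Quad.ClHasElementOfOrder δ n
proposition43 δ disc δ≢-3 n n-odd n∣δ n∣ε₂ α β b α²-4bⁿ≡δβ² gcd[b,α]≡1 gcd[β,n]≡1 _ =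
  IdealPowers.not-power⇒ClHasElementOfOrder δ {R = R} {S = S} (b≢0 gcd[b,α]≡1) μμ̄≡bⁿ 1≡Rμ+Sμ̄
    (μ-not-power δ≢-3 n∣δ n∣ε₂ gcd[β,n]≡1)
  where
  open QuadraticInteger δ
  open Solution δ disc n n-odd α β b α²-4bⁿ≡δβ²
  R S : A
  R = proj₁ (1∈⟨μ,μ̄⟩ gcd[b,α]≡1)
  S = proj₁ (proj₂ (1∈⟨μ,μ̄⟩ gcd[b,α]≡1))
  1≡Rμ+Sμ̄ : 1A ≡ R ⊙ μ ⊕ S ⊙ conj μ
  1≡Rμ+Sμ̄ = proj₂ (proj₂ (1∈⟨μ,μ̄⟩ gcd[b,α]≡1))
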